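{- For every $m\in\mathbb{Z}_{>0}$, $$\Gamma(m)=\mathcal{L}(S(m))\cup\{\mu\in\Lambda(m):\mu_1=0\text{ or }\mu_2=0\}.$$
   Context: Let $p$ be a prime, $\mathbb{F}=\mathbb{F}_p$, $S=\mathbb{F}[x,y]$, $\mathrm{Der}_S=S\partial_x\oplus S\partial_y$. Let $\mathcal{A}=\{H_1,H_2,H_3\}$ with $H_1=\ker x$, $H_2=\ker y$, $H_3=\ker(x+y)$, $\alpha_1=x,\alpha_2=y,\alpha_3=x+y$. For $\mu=(\mu_1,\mu_2,\mu_3)\in\Lambda\coloneqq\mathbb{Z}_{\ge0}^3$, $D(\mathcal{A},\mu)=\{\theta\in\mathrm{Der}_S:\theta(\alpha_i)\in\alpha_i^{\mu_i}S,\ i=1,2,3\}$. Let $\Lambda(m)=\{\mu\in\Lambda:\mu_3=m\}$, partially ordered componentwise ($\mu\subseteq\nu$ iff $\mu_i\le\nu_i$ for all $i$). For $\mu\in\Lambda(m)$ let $\psi_\mu=\sum_{j=\mu_1}^{m}\binom{m}{j}x^jy^{m-j}\partial_x+\sum_{j=0}^{\mu_1-1}\binom{m}{j}x^jy^{m-j}\partial_y$ (binomial coefficients read in $\mathbb{F}_p$; empty sums are zero) and $\psi'_\mu=x^{\mu_1}y^{\mu_2}(\partial_y-\partial_x)$, and let $\Gamma(m)=\{\mu\in\Lambda(m):\{\psi_\mu,\psi'_\mu\}\text{ is a basis for }D(\mathcal{A},\mu)\}$. Write the base-$p$ expansion $n=\sum_{e\ge0}c_e(n)p^e$ with $0\le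 c_e(n)<p$. Let $G_m=\{g\in\mathbb{Z}_{\ge0}: c_e(g)\le c_e(m)\text{ for all }e\ge0\}=\{g_0,g_1,\dots,g_t\}$ with $0=g_0<g_1<\dots<g_t=m$, and $S(m)=\{(g_i,g_{t-i+1},m): i\in\{1,\dots,t\}\}$. For $T\subseteq\Lambda(m)$, $\mathcal{L}(T)=\{\mu\in\Lambda(m):\mu\subseteq\nu\text{ for some }\nu\in T\}$ is the lower set generated by $T$. -}

module Defs where

open import Data.Nat as ℕ using (ℕ; zero; suc; _≤_; _<_; _≡ᵇ_; _≤ᵇ_; _∸_)
open import Data.Nat.DivMod using (_/_; _%_)
open import Data.Nat.Combinatorics using (_C_)
open import Data.Integer as ℤ using (ℤ; +_; 0ℤ; 1ℤ; -_)
open import Data.Integer.Divisibility using (_∣_)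
open import Data.List using (List; []; _∷_; applyUpTo)
open import Data.Bool using (if_then_else_; _∧_)
open import Data.Product using (Σ; ∃; _×_; _,_; proj₁; proj₂)
open import Data.Sum using (_⊎_)
open import Relation.Binary.PropositionalEquality using (_≡_)

-- Base-p digits:  digit p e n = c_e(n)  (the e-th base-p digit of n).
-- (p = 0 never occurs in the statement since p is prime.)

digit : ℕ → ℕ → ℕ → ℕ
digit zero    e       n = 0
digit (suc q) zero    n = n % suc q
digit (suc q) (suc e) n = digit (suc q) e (n / suc q)

InG : ℕ → ℕ → ℕ → Set
InG p m g = ∀ e → digit p e g ≤ digit p e m

-- A "series" is a coefficient function (i , j) ↦ coefficient of x^i y^j,
-- with integer coefficients read modulo p.  A polynomial is a series with
-- finite support.

Ser : Set
Ser = ℕ → ℕ → ℤ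

IsPoly : Ser → Set
IsPoly f = ∃ λ N → ∀ i j → N ≤ i ℕ.+ j → f i j ≡ 0ℤ

_≡[_]_ : ℤ → ℕ → ℤ → Set
a ≡[ p ] b = (+ p) ∣ (a ℤ.- b)

_≈[_]_ : Ser → ℕ → Ser → Set
f ≈[ p ] g = ∀ i j → f i j ≡[ p ] g i j

sumℤ : List ℤ → ℤ
sumℤ []       = 0ℤ
sumℤ (a ∷ as) = a ℤ.+ sumℤ as

sumBelow : ℕ → (ℕ → ℤ) → ℤ
sumBelow n h = sumℤ (applyUpTo h n)

sumRange : ℕ → ℕ → (ℕ → Ser) → Ser
sumRange lo hi h i j = sumℤ (applyUpTo (λ k → h (lo ℕ.+ k) i j) (hi ∸ lo))

zeroS : Ser
zeroS i j = 0ℤ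

_⊕_ : Ser → Ser → Ser
(f ⊕ g) i j = f i j ℤ.+ g i j

negS : Ser → Ser
negS f i j = - f i j

_⊗_ : Ser → Ser → Ser
(f ⊗ g) i j = sumBelow (suc i) λ a → sumBelow (suc j) λ b → f a b ℤ.* g (i ∸ a) (j ∸ b)

mono : ℤ → ℕ → ℕ → Ser
mono c a b i j = if (i ≡ᵇ a) ∧ (j ≡ᵇ b) then c else 0ℤ

oneS xS yS : Ser
oneS = mono 1ℤ 0 0
xS   = mono 1ℤ 1 0
yS   = mono 1ℤ 0 1

_^S_ : Ser → ℕ → Ser
f ^S zero  = oneS
f ^S suc n = f ⊗ (f ^S n)

Divides : ℕ → Ser → Ser → Set
Divides p a b = ∃ λ q → IsPoly q × (b ≈[ p ] (a ⊗ q))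

-- Derivations θ = f ∂x + g ∂y ∈ Der_S, represented by (f , g).
-- θ(x) = f, θ(y) = g, θ(x+y) = f + g.

Der : Set
Der = Ser × Ser

_≈D[_]_ : Der → ℕ → Der → Set
θ ≈D[ p ] η = (proj₁ θ ≈[ p ] proj₁ η) × (proj₂ θ ≈[ p ] proj₂ η)

IsDer : Der → Set
IsDer θ = IsPoly (proj₁ θ) × IsPoly (proj₂ θ)

Mult : Set
Mult = ℕ × ℕ × ℕ

μ₁ μ₂ μ₃ : Mult → ℕ
μ₁ μ = proj₁ μ
μ₂ μ = proj₁ (proj₂ μ)
μ₃ μ = proj₂ (proj₂ μ)

InD : ℕ → Mult → Der → Set
InD p μ θ =
  IsDer θ ×
  Divides p (xS ^S μ₁ μ) (proj₁ θ) ×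
  Divides p (yS ^S μ₂ μ) (proj₂ θ) ×
  Divides p ((xS ⊕ yS) ^S μ₃ μ) (proj₁ θ ⊕ proj₂ θ)

lin : Ser → Der → Ser → Der → Der
lin a θ b η = ((a ⊗ proj₁ θ) ⊕ (b ⊗ proj₁ η)) , ((a ⊗ proj₂ θ) ⊕ (b ⊗ proj₂ η))

IsBasisD : ℕ → Mult → Der → Der → Set
IsBasisD p μ θ η =
  InD p μ θ × InD p μ η ×
  (∀ ζ → InD p μ ζ → ∃ λ a → ∃ λ b → IsPoly a × IsPoly b × (ζ ≈D[ p ] lin a θ b η)) ×
  (∀ a b → IsPoly a → IsPoly b → lin a θ b η ≈D[ p ] (zeroS , zeroS) →
     (a ≈[ p ] zeroS) × (b ≈[ p ] zeroS))

binTerm : ℕ → ℕ → Ser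
binTerm m j = mono (+ (m C j)) j (m ∸ j)

ψ : Mult → Der
ψ μ = sumRange (μ₁ μ) (suc (μ₃ μ)) (binTerm (μ₃ μ)) , sumRange 0 (μ₁ μ) (binTerm (μ₃ μ))

ψ′ : Mult → Der
ψ′ μ = negS (mono 1ℤ (μ₁ μ) (μ₂ μ)) , mono 1ℤ (μ₁ μ) (μ₂ μ)

InΓ : ℕ → ℕ → Mult → Set
InΓ p m μ = (μ₃ μ ≡ m) × IsBasisD p μ (ψ μ) (ψ′ μ)

_⊆μ_ : Mult → Mult → Set
μ ⊆μ ν = (μ₁ μ ≤ μ₁ ν) × (μ₂ μ ≤ μ₂ ν) × (μ₃ μ ≤ μ₃ ν)

-- ν ∈ S(m), given the increasing enumeration g₀ < … < g_t of G_m
InS : ℕ → ℕ → (ℕ → ℕ) → Mult → Set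
InS m t g ν = ∃ λ i → (1 ≤ i) × (i ≤ t) × (ν ≡ (g i , g (t ∸ i ℕ.+ 1) , m))

InLS : ℕ → ℕ → (ℕ → ℕ) → Mult → Set
InLS m t g μ = (μ₃ μ ≡ m) × ∃ λ ν → InS m t g ν × (μ ⊆μ ν)

{-# OPTIONS --safe #-}
module Submission where

open import Defs
open import Data.Nat using (ℕ; _<_; _≤_; suc)
open import Data.Nat.Primality using (Prime)
open import Data.Product using (∃; _×_)
open import Data.Sum using (_⊎_)
open import Function.Bundles using (_⇔_)
open import Relation.Binary.PropositionalEquality using (_≡_)

-- ψ′_μ = x^μ₁ y^μ₂ (∂y − ∂x) always lies in D(A, μ), and ψ_μ does exactly when y^μ₂ divides
-- its ∂y-coefficient Σ_{i<μ₁} C(m,i) x^i y^(m−i), i.e. when p ∣ C(m,i) for all i < μ₁ with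
-- m − i < μ₂.  The pair is then a basis: for θ = f ∂x + g ∂y ∈ D(A, μ) we have f + g = h (x+y)^m,
-- and g − h ψ_μ(y) = h ψ_μ(x) − f is divisible by both x^μ₁ and y^μ₂, hence equals B x^μ₁ y^μ₂,
-- giving θ = h ψ_μ + B ψ′_μ.  Independence holds because (x+y)^m, whose y^m-coefficient is 1, is
-- not a zero divisor.  By Lucas' theorem p ∤ C(m,i) iff i ∈ G_m, and G_m is symmetric under
-- i ↦ m − i, so g_{t−k} = m − g_k.  The binomial condition thus says that no g_k has g_k < μ₁ and
-- g_{t−k} < μ₂; for the least k with μ₁ ≤ g_k this means μ ⊆ (g_k, g_{t−k+1}, m), unless μ₁ = 0
-- or μ₂ = 0.

module Lucas where

  open import Data.Nat
  open import Data.Nat.Properties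
  open import Data.Nat.Combinatorics
  open import Data.Nat.DivMod
  open import Data.Nat.Divisibility
  open import Data.Nat.Induction using (<-rec)
  open import Data.Nat.Primality using (euclidsLemma; prime⇒nonTrivial)
  open import Data.Product using (_,_)
  open import Data.Product.Function.NonDependent.Propositional using (_×-⇔_)
  open import Data.Sum using (inj₁; inj₂)
  open import Function.Bundles using (mk⇔; Equivalence)
  open import Function.Properties.Equivalence using (⇔-setoid)
  open import Function.Related.TypeIsomorphisms using (¬-cong-⇔)
  open import Level using (0ℓ)
  open import Relation.Nullary using (¬_; yes; no; contradiction)
  open import Relation.Nullary.Decidable using (decidable-stable)
  open import Function.Base using (_∘_)
  open import Relation.Binary.PropositionalEquality

  nCk*[k!*[n∸k]!]≡n! : ∀ {n k} → k ≤ n → (n C k) * (k ! * (n ∸ k) !) ≡ n !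
  nCk*[k!*[n∸k]!]≡n! {n} {k} k≤n =
    trans (cong (_* (k ! * (n ∸ k) !)) (nCk≡n!/k![n-k]! k≤n)) (m/n*n≡m (k![n∸k]!∣n! k≤n))
    where instance _ = k !* (n ∸ k) !≢0

  module _ {q : ℕ} (p-prime : Prime (suc q)) where

    private
      p : ℕ
      p = suc q

    1<p : 1 < p
    1<p = nonTrivial⇒n>1 p {{prime⇒nonTrivial p-prime}}

    p∤n : ∀ {n} → 0 < n → n < p → ¬ p ∣ n
    p∤n 0<n n<p p∣n = <⇒≱ n<p (∣⇒≤ {{>-nonZero 0<n}} p∣n)

    p∤n! : ∀ {n} → n < p → ¬ p ∣ n !
    p∤n! {zero}  _   = p∤n z<s 1<p
    p∤n! {suc n} n<p p∣n! with euclidsLemma (suc n) (n !) p-prime p∣n!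
    ... | inj₁ p∣1+n = p∤n z<s n<p p∣1+n
    ... | inj₂ p∣n!  = p∤n! (<-trans (n<1+n n) n<p) p∣n!

    p∤nCk : ∀ {n k} → k ≤ n → n < p → ¬ p ∣ n C k
    p∤nCk {n} {k} k≤n n<p p∣nCk =
      p∤n! n<p (subst (p ∣_) (nCk*[k!*[n∸k]!]≡n! k≤n) (∣-trans p∣nCk (m∣m*n _)))

    p∣pCk : ∀ {k} → 0 < k → k < p → p ∣ p C k
    p∣pCk {k} 0<k k<p with euclidsLemma (p C k) (k ! * (p ∸ k) !) p-prime
                            (subst (p ∣_) (sym (nCk*[k!*[n∸k]!]≡n! (<⇒≤ k<p))) (m∣m*n (q !)))
    ... | inj₁ p∣pCk = p∣pCk
    ... | inj₂ p∣k!*[p∸k]! with euclidsLemma (k !) ((p ∸ k) !) p-prime p∣k!*[p∸k]!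
    ...   | inj₁ p∣k!     = contradiction p∣k! (p∤n! k<p)
    ...   | inj₂ p∣[p∸k]! = contradiction p∣[p∸k]! (p∤n! (∸-monoʳ-< 0<k (<⇒≤ k<p)))

    infix 4 _≡ₚ_
    _≡ₚ_ : ℕ → ℕ → Set
    x ≡ₚ y = x % p ≡ y % p

    +-congₚ : ∀ {x y u v} → x ≡ₚ y → u ≡ₚ v → x + u ≡ₚ y + v
    +-congₚ {x} {y} {u} {v} x≡y u≡v = begin
      (x + u) % p             ≡⟨ %-distribˡ-+ x u p ⟩
      (x % p + u % p) % p     ≡⟨ cong₂ (λ a b → (a + b) % p) x≡y u≡v ⟩
      (y % p + v % p) % p     ≡⟨ %-distribˡ-+ y v p ⟨
      (y + v) % p             ∎
      where open ≡-Reasoning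

    ∣-respects-≡ₚ : ∀ {x y} → x ≡ₚ y → p ∣ x → p ∣ y
    ∣-respects-≡ₚ {x} {y} x≡y p∣x = m%n≡0⇒n∣m y p (trans (sym x≡y) (n∣m⇒m%n≡0 x p p∣x))

    -- The two-digit base-p numeral (a, b) is the successor of (a′, b′).
    data Decrement : ℕ → ℕ → ℕ → ℕ → Set where
      inner  : ∀ a b → Decrement a (suc b) a b
      borrow : ∀ a   → Decrement (suc a) 0 a q

    decrement-value : ∀ {a b a′ b′} → Decrement a b a′ b′ → a * p + b ≡ suc (a′ * p + b′)
    decrement-value (inner a b) = +-suc (a * p) b
    decrement-value (borrow a)  = trans (+-identityʳ (p + a * p)) (cong suc (+-comm q (a * p)))

    decrement-< : ∀ {a b a′ b′} → b < p → Decrement a b a′ b′ → b′ < p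
    decrement-< b<p (inner _ _) = <-trans (n<1+n _) b<p
    decrement-< _   (borrow _)  = n<1+n q

    digit-pascal : ∀ {a b a′ b′ c d c′ d′} → b < p → d < p →
                   Decrement a b a′ b′ → Decrement c d c′ d′ →
                   (a′ C c′) * (b′ C d′) + (a′ C c) * (b′ C d) ≡ₚ (a C c) * (b C d)
    digit-pascal _ _ (inner a b′) (inner c d′) = cong (_% p) (begin
      (a C c) * (b′ C d′) + (a C c) * (b′ C suc d′)   ≡⟨ *-distribˡ-+ (a C c) (b′ C d′) (b′ C suc d′) ⟨
      (a C c) * (b′ C d′ + b′ C suc d′)               ≡⟨ cong ((a C c) *_) (nCk+nC[k+1]≡[n+1]C[k+1] b′ d′) ⟩
      (a C c) * (suc b′ C suc d′)                     ∎)
      where open ≡-Reasoning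
    digit-pascal (s≤s b<p) _ (inner a b′) (borrow c′) = cong (_% p) (begin
      (a C c′) * (b′ C q) + (a C suc c′) * 1   ≡⟨ cong (λ x → (a C c′) * x + (a C suc c′) * 1) (k>n⇒nCk≡0 b<p) ⟩
      (a C c′) * 0 + (a C suc c′) * 1          ≡⟨ cong (_+ (a C suc c′) * 1) (*-zeroʳ (a C c′)) ⟩
      (a C suc c′) * 1                          ∎)
      where open ≡-Reasoning
    digit-pascal _ d<p (borrow a′) (inner c d′) = begin
      ((a′ C c) * (q C d′) + (a′ C c) * (q C suc d′)) % p  ≡⟨ cong (_% p) (*-distribˡ-+ (a′ C c) (q C d′) (q C suc d′)) ⟨
      ((a′ C c) * (q C d′ + q C suc d′)) % p               ≡⟨ cong (λ x → ((a′ C c) * x) % p) (nCk+nC[k+1]≡[n+1]C[k+1] q d′) ⟩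
      ((a′ C c) * (p C suc d′)) % p                        ≡⟨ n∣m⇒m%n≡0 _ p (∣n⇒∣m*n (a′ C c) (p∣pCk z<s d<p)) ⟩
      0                                                    ≡⟨ cong (_% p) (*-zeroʳ (suc a′ C c)) ⟨
      ((suc a′ C c) * 0) % p                               ∎
      where open ≡-Reasoning
    digit-pascal _ _ (borrow a′) (borrow c′) = cong (_% p) (begin
      (a′ C c′) * (q C q) + (a′ C suc c′) * 1   ≡⟨ cong (λ x → (a′ C c′) * x + (a′ C suc c′) * 1) (nCn≡1 q) ⟩
      (a′ C c′) * 1 + (a′ C suc c′) * 1         ≡⟨ *-distribʳ-+ 1 (a′ C c′) (a′ C suc c′) ⟨
      ((a′ C c′) + (a′ C suc c′)) * 1           ≡⟨ cong (_* 1) (nCk+nC[k+1]≡[n+1]C[k+1] a′ c′) ⟩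
      (suc a′ C suc c′) * 1                     ∎)
      where open ≡-Reasoning

    lucas-step : ∀ {a b a′ b′ c d c′ d′} → b < p → d < p →
                 Decrement a b a′ b′ → Decrement c d c′ d′ →
                 (∀ c d → d < p → (a′ * p + b′) C (c * p + d) ≡ₚ (a′ C c) * (b′ C d)) →
                 (a * p + b) C (c * p + d) ≡ₚ (a C c) * (b C d)
    lucas-step {a} {b} {a′} {b′} {c} {d} {c′} {d′} b<p d<p ab cd ih = begin
      ((a * p + b) C (c * p + d)) % p
        ≡⟨ cong₂ (λ x y → (x C y) % p) (decrement-value ab) (decrement-value cd) ⟩
      (suc n C suc k) % p
        ≡⟨ cong (_% p) (nCk+nC[k+1]≡[n+1]C[k+1] n k) ⟨
      (n C k + n C suc k) % p
        ≡⟨ +-congₚ {n C k} {(a′ C c′) * (b′ C d′)} (ih c′ d′ (decrement-< d<p cd))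
             (subst (λ y → n C y ≡ₚ (a′ C c) * (b′ C d)) (decrement-value cd) (ih c d d<p)) ⟩
      ((a′ C c′) * (b′ C d′) + (a′ C c) * (b′ C d)) % p
        ≡⟨ digit-pascal b<p d<p ab cd ⟩
      ((a C c) * (b C d)) % p ∎
      where
      open ≡-Reasoning
      n k : ℕ
      n = a′ * p + b′
      k = c′ * p + d′

    lucas : ∀ a b → b < p → ∀ c d → d < p → (a * p + b) C (c * p + d) ≡ₚ (a C c) * (b C d)
    lucas a       b       _   zero    zero    _   = refl
    lucas zero    zero    _   c       (suc d) _   =
      cong (_% p) (trans (cong (0 C_) (+-suc (c * p) d)) (sym (*-zeroʳ (0 C c))))
    lucas zero    zero    _   (suc c) zero    _   = refl
    lucas a       (suc b) b<p c       (suc d) d<p =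
      lucas-step b<p d<p (inner a b) (inner c d) (lucas a b (<-trans (n<1+n b) b<p))
    lucas a       (suc b) b<p (suc c) zero    d<p =
      lucas-step b<p d<p (inner a b) (borrow c)  (lucas a b (<-trans (n<1+n b) b<p))
    lucas (suc a) zero    b<p c       (suc d) d<p =
      lucas-step b<p d<p (borrow a)  (inner c d) (lucas a q (n<1+n q))
    lucas (suc a) zero    b<p (suc c) zero    d<p =
      lucas-step b<p d<p (borrow a)  (borrow c)  (lucas a q (n<1+n q))

    lucas-divmod : ∀ m j → m C j ≡ₚ (m / p C j / p) * (m % p C j % p)
    lucas-divmod m j = subst₂ (λ x y → x C y ≡ₚ (m / p C j / p) * (m % p C j % p)) (divmod m) (divmod j)
      (lucas (m / p) (m % p) (m%n<n m p) (j / p) (j % p) (m%n<n j p))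
      where
      divmod : ∀ x → x / p * p + x % p ≡ x
      divmod x = trans (+-comm (x / p * p) (x % p)) (sym (m≡m%n+[m/n]*n x p))

    digit-of-0 : ∀ e → digit p e 0 ≡ 0
    digit-of-0 zero    = refl
    digit-of-0 (suc e) = digit-of-0 e

    InG-0 : ∀ m → InG p m 0
    InG-0 m e = subst (_≤ digit p e m) (sym (digit-of-0 e)) z≤n

    InG-digits : ∀ {m j} → InG p m j ⇔ (InG p (m / p) (j / p) × j % p ≤ m % p)
    InG-digits = mk⇔ (λ j⊑m → j⊑m ∘ suc , j⊑m 0) λ where
      (j⊑m , _)   (suc e) → j⊑m e
      (_ , j₀≤m₀) zero    → j₀≤m₀

    p∤xy⇔p∤x×p∤y : ∀ {x y} → (¬ p ∣ x * y) ⇔ (¬ p ∣ x × ¬ p ∣ y)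
    p∤xy⇔p∤x×p∤y {x} {y} = mk⇔
      (λ p∤xy → p∤xy ∘ (λ p∣x → ∣-trans p∣x (m∣m*n y)) , p∤xy ∘ (λ p∣y → ∣-trans p∣y (n∣m*n x)))
      (λ (p∤x , p∤y) p∣xy → Data.Sum.[ p∤x , p∤y ] (euclidsLemma x y p-prime p∣xy))

    p∤nCk⇔k≤n : ∀ {n k} → n < p → (¬ p ∣ n C k) ⇔ k ≤ n
    p∤nCk⇔k≤n {n} {k} n<p = mk⇔ k≤n (λ k≤n → p∤nCk k≤n n<p)
      where
      k≤n : ¬ p ∣ n C k → k ≤ n
      k≤n p∤nCk with k ≤? n
      ... | yes k≤n = k≤n
      ... | no  k≰n = contradiction (subst (p ∣_) (sym (k>n⇒nCk≡0 (≰⇒> k≰n))) (p ∣0)) p∤nCk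

    p∤mCj⇔InG : ∀ j m → (¬ p ∣ m C j) ⇔ InG p m j
    p∤mCj⇔InG = <-rec _ step
      where
      open import Relation.Binary.Reasoning.Setoid (⇔-setoid 0ℓ)
      step : ∀ j → (∀ {i} → i < j → ∀ m → (¬ p ∣ m C i) ⇔ InG p m i) → ∀ m → (¬ p ∣ m C j) ⇔ InG p m j
      step zero        _   m = mk⇔ (λ _ → InG-0 m) (λ _ → p∤n z<s 1<p)
      step j@(suc _) rec m = begin
        (¬ p ∣ m C j)
          ≈⟨ ¬-cong-⇔ (mk⇔ (∣-respects-≡ₚ (lucas-divmod m j)) (∣-respects-≡ₚ (sym (lucas-divmod m j)))) ⟩
        (¬ p ∣ (m / p C j / p) * (m % p C j % p))
          ≈⟨ p∤xy⇔p∤x×p∤y ⟩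
        (¬ p ∣ m / p C j / p × ¬ p ∣ m % p C j % p)
          ≈⟨ rec (m/n<m j p 1<p) (m / p) ×-⇔ p∤nCk⇔k≤n (m%n<n m p) ⟩
        (InG p (m / p) (j / p) × j % p ≤ m % p)
          ≈⟨ InG-digits ⟨
        InG p m j ∎

    p∣mCj⇔¬InG : ∀ {m j} → p ∣ m C j ⇔ (¬ InG p m j)
    p∣mCj⇔¬InG {m} {j} = mk⇔
      (λ p∣mCj j⊑m → Equivalence.from (p∤mCj⇔InG j m) j⊑m p∣mCj)
      (λ j⋢m → decidable-stable (p ∣? m C j) (j⋢m ∘ Equivalence.to (p∤mCj⇔InG j m)))

    InG-sym : ∀ {m j} → j ≤ m → InG p m j → InG p m (m ∸ j)
    InG-sym {m} {j} j≤m j⊑m = Equivalence.to (p∤mCj⇔InG (m ∸ j) m)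
      (subst (λ x → ¬ p ∣ x) (nCk≡nC[n∸k] j≤m) (Equivalence.from (p∤mCj⇔InG j m) j⊑m))

module Enumeration where

  open import Data.Nat
  open import Data.Nat.Properties
  open import Data.Nat.Combinatorics
  open import Data.Nat.Divisibility
  open import Data.Nat.Induction using (<-rec)
  open import Data.Product using (_,_)
  open import Data.Sum using (inj₁; inj₂)
  open import Function.Base using (_∘_)
  open import Function.Bundles using (mk⇔; Equivalence)
  open import Relation.Nullary using (¬_; yes; no; contradiction)
  open import Relation.Binary.PropositionalEquality
  open import Relation.Binary.Definitions using (tri<; tri≈; tri>)
  open Lucas

  StrictlyIncreasingOn : ℕ → (ℕ → ℕ) → Set
  StrictlyIncreasingOn t g = ∀ {i j} → i < j → j ≤ t → g i < g j

  ImageOn : ℕ → (ℕ → ℕ) → ℕ → Set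
  ImageOn t g n = ∃ λ i → i ≤ t × g i ≡ n

  module _ {t : ℕ} {g : ℕ → ℕ} (g↑ : StrictlyIncreasingOn t g) where

    monotoneOn : ∀ {i j} → i ≤ j → j ≤ t → g i ≤ g j
    monotoneOn i≤j j≤t with m≤n⇒m<n∨m≡n i≤j
    ... | inj₁ i<j  = <⇒≤ (g↑ i<j j≤t)
    ... | inj₂ refl = ≤-refl

    reflects-< : ∀ {i j} → i ≤ t → g i < g j → i < j
    reflects-< {i} {j} i≤t gi<gj with <-cmp i j
    ... | tri< i<j _ _ = i<j
    ... | tri≈ _ refl _ = contradiction gi<gj (<-irrefl refl)
    ... | tri> _ _ j<i = contradiction gi<gj (<-asym (g↑ j<i i≤t))

    crossing : ∀ {a n} → g 0 < a → a ≤ g n → ∃ λ k → k < n × g k < a × a ≤ g (suc k)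
    crossing {a} {zero}  g0<a a≤g0 = contradiction a≤g0 (<⇒≱ g0<a)
    crossing {a} {suc n} g0<a a≤gn+1 with a ≤? g n
    ... | yes a≤gn = let k , k<n , rest = crossing g0<a a≤gn in k , m<n⇒m<1+n k<n , rest
    ... | no  a≰gn = n , n<1+n n , ≰⇒> a≰gn , a≤gn+1

  step-increasing⇒increasing : ∀ {t g} → (∀ i → i < t → g i < g (suc i)) → StrictlyIncreasingOn t g
  step-increasing⇒increasing {g = g} step {i} {suc j} (s≤s i≤j) j<t with m≤n⇒m<n∨m≡n i≤j
  ... | inj₁ i<j  = <-trans (step-increasing⇒increasing step i<j (<⇒≤ j<t)) (step j j<t)
  ... | inj₂ refl = step j j<t

  -- If g and h agree below k, then g attains h k at no index below k, so g k ≤ h k; and symmetrically.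
  increasing-unique : ∀ {t g h} → StrictlyIncreasingOn t g → StrictlyIncreasingOn t h →
                      (∀ n → ImageOn t g n ⇔ ImageOn t h n) → ∀ k → k ≤ t → g k ≡ h k
  increasing-unique {t} {g} {h} g↑ h↑ same = <-rec _ step
    where
    below : ∀ {f f′ k} → StrictlyIncreasingOn t f → StrictlyIncreasingOn t f′ →
            (∀ {i} → i < k → f i ≡ f′ i) → k ≤ t → ImageOn t f (f′ k) → f k ≤ f′ k
    below {f} {f′} {k} f↑ f′↑ agree k≤t (j , j≤t , fj≡f′k) with j <? k
    ... | yes j<k = contradiction (f′↑ j<k k≤t) (<-irrefl (trans (sym (agree j<k)) fj≡f′k))
    ... | no  j≮k = subst (f k ≤_) fj≡f′k (monotoneOn f↑ (≮⇒≥ j≮k) j≤t)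
    step : ∀ k → (∀ {i} → i < k → i ≤ t → g i ≡ h i) → k ≤ t → g k ≡ h k
    step k rec k≤t = ≤-antisym
      (below g↑ h↑ agree k≤t (Equivalence.from (same (h k)) (k , k≤t , refl)))
      (below h↑ g↑ (sym ∘ agree) k≤t (Equivalence.to (same (g k)) (k , k≤t , refl)))
      where
      agree : ∀ {i} → i < k → g i ≡ h i
      agree i<k = rec i<k (<⇒≤ (<-≤-trans i<k k≤t))

  BinomialsVanish : ℕ → ℕ → ℕ → ℕ → Set
  BinomialsVanish p m a b = ∀ i → i < a → m ∸ i < b → p ∣ m C i

  Corner : ℕ → (ℕ → ℕ) → ℕ → ℕ → Set
  Corner t g a b = ∃ λ i → 1 ≤ i × i ≤ t × a ≤ g i × b ≤ g (t ∸ i + 1)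

  t∸[1+k]+1≡t∸k : ∀ {t k} → k < t → t ∸ suc k + 1 ≡ t ∸ k
  t∸[1+k]+1≡t∸k {t} {k} k<t = trans (+-comm (t ∸ suc k) 1) (sym (+-∸-assoc 1 k<t))

  module _ {q m t g} (p-prime : Prime (suc q))
           (g0≡0 : g 0 ≡ 0) (gt≡m : g t ≡ m) (g↑ : StrictlyIncreasingOn t g)
           (enum : ∀ n → InG (suc q) m n ⇔ ImageOn t g n) where

    private
      p : ℕ
      p = suc q

    g∈G : ∀ {i} → i ≤ t → InG p m (g i)
    g∈G {i} i≤t = Equivalence.from (enum (g i)) (i , i≤t , refl)

    g≤m : ∀ {i} → i ≤ t → g i ≤ m
    g≤m i≤t = subst (_ ≤_) gt≡m (monotoneOn g↑ i≤t ≤-refl)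

    -- k ↦ m ∸ g (t ∸ k) enumerates G_m increasingly as well, since G_m is symmetric.
    g-sym : ∀ {k} → k ≤ t → g (t ∸ k) ≡ m ∸ g k
    g-sym {k} k≤t = trans (g≡m∸g[t∸] (m∸n≤m t k)) (cong (λ i → m ∸ g i) (m∸[m∸n]≡n k≤t))
      where
      h : ℕ → ℕ
      h k = m ∸ g (t ∸ k)
      h↑ : StrictlyIncreasingOn t h
      h↑ {i} i<j j≤t = ∸-monoʳ-< (g↑ (∸-monoʳ-< i<j j≤t) (m∸n≤m t i)) (g≤m (m∸n≤m t i))
      h-enum : ∀ n → InG p m n ⇔ ImageOn t h n
      h-enum n = mk⇔ to (λ where (k , _ , refl) → InG-sym p-prime (g≤m (m∸n≤m t k)) (g∈G (m∸n≤m t k)))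
        where
        to : InG p m n → ImageOn t h n
        to n∈G with Equivalence.to (enum n) n∈G
        ... | (j , j≤t , refl) with Equivalence.to (enum (m ∸ g j)) (InG-sym p-prime (g≤m j≤t) n∈G)
        ... | (i , i≤t , gi≡m∸gj) = t ∸ i , m∸n≤m t i , (begin
          m ∸ g (t ∸ (t ∸ i))  ≡⟨ cong (λ l → m ∸ g l) (m∸[m∸n]≡n i≤t) ⟩
          m ∸ g i              ≡⟨ cong (m ∸_) gi≡m∸gj ⟩
          m ∸ (m ∸ g j)        ≡⟨ m∸[m∸n]≡n (g≤m j≤t) ⟩
          g j                  ∎)
          where open ≡-Reasoning
      g≡m∸g[t∸] : ∀ {k} → k ≤ t → g k ≡ m ∸ g (t ∸ k)
      g≡m∸g[t∸] = increasing-unique g↑ h↑ (λ n → mk⇔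
        (Equivalence.to (h-enum n) ∘ Equivalence.from (enum n))
        (Equivalence.to (enum n) ∘ Equivalence.from (h-enum n))) _

    vanish⇒corner : ∀ {a b} → BinomialsVanish p m a b → Corner t g a b ⊎ (a ≡ 0 ⊎ b ≡ 0)
    vanish⇒corner {zero}          _ = inj₂ (inj₁ refl)
    vanish⇒corner {suc _} {zero}  _ = inj₂ (inj₂ refl)
    vanish⇒corner {a@(suc _)} {b@(suc _)} vanish =
      let k , k<t , gk<a , a≤g[1+k] = crossing g↑ (subst (_< a) (sym g0≡0) z<s) (subst (a ≤_) (sym gt≡m) a≤m)
      in inj₁ (suc k , s≤s z≤n , k<t , a≤g[1+k] , subst (b ≤_) (sym (b≤-target k<t)) (b≤m∸gk gk<a k<t))
      where
      a≤m : a ≤ m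
      a≤m with a ≤? m
      ... | yes a≤m = a≤m
      ... | no  a≰m = contradiction (subst (p ∣_) (nCn≡1 m) (vanish m (≰⇒> a≰m) (subst (_< b) (sym (n∸n≡0 m)) z<s)))
                                    (p∤n p-prime z<s (1<p p-prime))
      b≤-target : ∀ {k} → k < t → g (t ∸ suc k + 1) ≡ m ∸ g k
      b≤-target k<t = trans (cong g (t∸[1+k]+1≡t∸k k<t)) (g-sym (<⇒≤ k<t))
      b≤m∸gk : ∀ {k} → g k < a → k < t → b ≤ m ∸ g k
      b≤m∸gk {k} gk<a k<t with b ≤? m ∸ g k
      ... | yes b≤ = b≤
      ... | no  b≰ = contradiction (vanish (g k) gk<a (≰⇒> b≰))
                                   (Equivalence.from (p∤mCj⇔InG p-prime (g k) m) (g∈G (<⇒≤ k<t)))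

    corner⇒vanish : ∀ {a b} → Corner t g a b ⊎ (a ≡ 0 ⊎ b ≡ 0) → BinomialsVanish p m a b
    corner⇒vanish (inj₂ (inj₁ refl)) _ ()
    corner⇒vanish (inj₂ (inj₂ refl)) _ _ ()
    corner⇒vanish {a} {b} (inj₁ (suc k , _ , k<t , a≤g[1+k] , b≤g[t∸k])) i i<a m∸i<b =
      Equivalence.from (p∣mCj⇔¬InG p-prime) i∉G
      where
      i∉G : ¬ InG p m i
      i∉G i∈G with Equivalence.to (enum i) i∈G
      ... | (l , l≤t , refl) = <⇒≱ m∸i<b (begin
        b                   ≤⟨ b≤g[t∸k] ⟩
        g (t ∸ suc k + 1)   ≡⟨ cong g (t∸[1+k]+1≡t∸k k<t) ⟩
        g (t ∸ k)           ≤⟨ monotoneOn g↑ (∸-monoʳ-≤ t (≤-pred (reflects-< g↑ l≤t (<-≤-trans i<a a≤g[1+k])))) (m∸n≤m t l) ⟩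
        g (t ∸ l)           ≡⟨ g-sym l≤t ⟩
        m ∸ g l             ∎)
        where open ≤-Reasoning

    vanish⇔corner : ∀ {a b} → BinomialsVanish p m a b ⇔ (Corner t g a b ⊎ (a ≡ 0 ⊎ b ≡ 0))
    vanish⇔corner = mk⇔ vanish⇒corner corner⇒vanish

module Congruence (p : ℕ) where

  open import Data.Nat.Divisibility using (_∣_)
  import Data.Nat.Properties as ℕ
  open import Data.Integer using (ℤ; +_; 0ℤ; _+_; _-_; _*_; -_)
  open import Data.Integer.Properties using (+-inverseʳ)
  open import Data.Integer.Tactic.RingSolver using (solve-∀)
  import Data.Integer.Divisibility.Signed as Signed
  open import Function.Base using (_∘_)
  open import Function.Bundles using (mk⇔; Equivalence)
  open import Relation.Binary.Bundles using (Setoid)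
  open import Relation.Binary.PropositionalEquality using (refl; sym; subst)

  infix 4 _≈_
  record _≈_ (a b : ℤ) : Set where
    constructor mod-p
    field p∣a-b : + p Signed.∣ (a - b)
  open _≈_

  ≈⇔≡[p] : ∀ a b → a ≈ b ⇔ a ≡[ p ] b
  ≈⇔≡[p] _ _ = mk⇔ (Signed.∣⇒∣ᵤ ∘ p∣a-b) (mod-p ∘ Signed.∣ᵤ⇒∣)

  private
    by : ∀ {a b x} → x ≡ a - b → + p Signed.∣ x → a ≈ b
    by x≡a-b p∣x = mod-p (subst (+ p Signed.∣_) x≡a-b p∣x)

  ≈-refl : ∀ {a} → a ≈ a
  ≈-refl {a} = mod-p (Signed.divides 0ℤ (+-inverseʳ a))

  ≈-sym : ∀ {a b} → a ≈ b → b ≈ a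
  ≈-sym {a} {b} (mod-p a≡b) = by (eq a b) (Signed.∣m⇒∣-m a≡b)
    where eq : ∀ a b → - (a - b) ≡ b - a
          eq = solve-∀

  ≈-trans : ∀ {a b c} → a ≈ b → b ≈ c → a ≈ c
  ≈-trans {a} {b} {c} (mod-p a≡b) (mod-p b≡c) = by (eq a b c) (Signed.∣m∣n⇒∣m+n a≡b b≡c)
    where eq : ∀ a b c → (a - b) + (b - c) ≡ a - c
          eq = solve-∀

  ≈-reflexive : ∀ {a b} → a ≡ b → a ≈ b
  ≈-reflexive refl = ≈-refl

  +-cong : ∀ {a b c d} → a ≈ b → c ≈ d → a + c ≈ b + d
  +-cong {a} {b} {c} {d} (mod-p a≡b) (mod-p c≡d) = by (eq a b c d) (Signed.∣m∣n⇒∣m+n a≡b c≡d)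
    where eq : ∀ a b c d → (a - b) + (c - d) ≡ (a + c) - (b + d)
          eq = solve-∀

  *-cong : ∀ {a b c d} → a ≈ b → c ≈ d → a * c ≈ b * d
  *-cong {a} {b} {c} {d} (mod-p a≡b) (mod-p c≡d) =
    by (eq a b c d) (Signed.∣m∣n⇒∣m+n (Signed.∣m⇒∣m*n c a≡b) (Signed.∣n⇒∣m*n b c≡d))
    where eq : ∀ a b c d → (a - b) * c + b * (c - d) ≡ a * c - b * d
          eq = solve-∀

  -‿cong : ∀ {a b} → a ≈ b → - a ≈ - b
  -‿cong {a} {b} (mod-p a≡b) = by (eq a b) (Signed.∣m⇒∣-m a≡b)
    where eq : ∀ a b → - (a - b) ≡ - a - - b
          eq = solve-∀

  +n≈0⇔p∣n : ∀ n → + n ≈ 0ℤ ⇔ p ∣ n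
  +n≈0⇔p∣n n = mk⇔ (λ n≈0 → subst (p ∣_) (ℕ.+-identityʳ n) (Equivalence.to (≈⇔≡[p] (+ n) 0ℤ) n≈0))
                   (λ p∣n → Equivalence.from (≈⇔≡[p] (+ n) 0ℤ) (subst (p ∣_) (sym (ℕ.+-identityʳ n)) p∣n))

  u+v≈x+y⇒v-y≈x-u : ∀ {u v x y} → u + v ≈ x + y → v - y ≈ x - u
  u+v≈x+y⇒v-y≈x-u {u} {v} {x} {y} (mod-p p∣) = by (eq u v x y) p∣
    where eq : ∀ u v x y → (u + v) - (x + y) ≡ (v - y) - (x - u)
          eq = solve-∀

  ≈-setoid : Setoid _ _
  ≈-setoid = record
    { Carrier = ℤ
    ; _≈_ = _≈_
    ; isEquivalence = record { refl = ≈-refl ; sym = ≈-sym ; trans = ≈-trans }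
    }

module Series where

  open import Data.Nat as ℕ using (zero; z≤n; s≤s; z<s; _∸_; _≡ᵇ_)
  import Data.Nat.Properties as ℕ
  open import Data.Integer using (ℤ; +_; 0ℤ; 1ℤ; _+_; _*_; -_)
  import Algebra.Properties.CommutativeSemigroup
  import Data.Integer.Properties
  open import Data.Integer.Properties using (neg-distrib-+; neg-distribʳ-*; *-comm; *-distribˡ-+; *-distribʳ-+; +-identityˡ; +-identityʳ; +-assoc; +-comm; *-zeroʳ; *-identityˡ)
  open import Data.Nat.Combinatorics using (_C_; nCk+nC[k+1]≡[n+1]C[k+1]; k>n⇒nCk≡0)
  open import Relation.Nullary using (yes; no)
  open import Data.Bool using (true; false; _∧_; if_then_else_)
  open import Data.Bool.Properties using (∧-zeroʳ; if-eta)
  open import Relation.Nullary.Decidable using (dec-true; dec-false)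
  open import Data.Product using (_,_)
  open import Data.Sum using (inj₁; inj₂)
  open import Function.Base using (_∘_; id)
  open import Relation.Binary.PropositionalEquality using (_≢_; refl; sym; trans; cong; cong₂; subst; module ≡-Reasoning)

  private
    module ℕ+ = Algebra.Properties.CommutativeSemigroup ℕ.+-commutativeSemigroup
    module ℤ+ = Algebra.Properties.CommutativeSemigroup Data.Integer.Properties.+-commutativeSemigroup

  sum-cong : ∀ n {h h′ : ℕ → ℤ} → (∀ {k} → k < n → h k ≡ h′ k) → sumBelow n h ≡ sumBelow n h′
  sum-cong zero    _     = refl
  sum-cong (suc n) h≡h′ = cong₂ _+_ (h≡h′ z<s) (sum-cong n (h≡h′ ∘ s≤s))

  sum-zero : ∀ n {h : ℕ → ℤ} → (∀ {k} → k < n → h k ≡ 0ℤ) → sumBelow n h ≡ 0ℤ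
  sum-zero zero    _    = refl
  sum-zero (suc n) h≡0 = cong₂ _+_ (h≡0 z<s) (sum-zero n (h≡0 ∘ s≤s))

  sum-single : ∀ {n k₀} {h : ℕ → ℤ} → k₀ < n → (∀ {k} → k < n → k ≢ k₀ → h k ≡ 0ℤ) → sumBelow n h ≡ h k₀
  sum-single {suc n} {zero}   {h} _ h≡0 =
    trans (cong (_+_ (h 0)) (sum-zero n (λ k<n → h≡0 (s≤s k<n) λ ())))  (+-identityʳ (h 0))
  sum-single {suc n} {suc k₀} {h} (s≤s k₀<n) h≡0 =
    trans (cong₂ _+_ (h≡0 z<s λ ()) (sum-single k₀<n λ k<n k≢k₀ → h≡0 (s≤s k<n) (k≢k₀ ∘ ℕ.suc-injective)))
          (+-identityˡ (h (suc k₀)))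

  sum-+ : ∀ n (h h′ : ℕ → ℤ) → sumBelow n (λ k → h k + h′ k) ≡ sumBelow n h + sumBelow n h′
  sum-+ zero    h h′ = refl
  sum-+ (suc n) h h′ = trans (cong (_+_ (h 0 + h′ 0)) (sum-+ n (h ∘ suc) (h′ ∘ suc))) (ℤ+.interchange (h 0) (h′ 0) _ _)

  sum-neg : ∀ n (h : ℕ → ℤ) → sumBelow n (λ k → - h k) ≡ - sumBelow n h
  sum-neg zero    h = refl
  sum-neg (suc n) h = trans (cong (_+_ (- h 0)) (sum-neg n (h ∘ suc))) (sym (neg-distrib-+ (h 0) _))

  sum-last : ∀ n (h : ℕ → ℤ) → sumBelow (suc n) h ≡ sumBelow n h + h n
  sum-last zero    h = trans (+-identityʳ (h 0)) (sym (+-identityˡ (h 0)))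
  sum-last (suc n) h = trans (cong (_+_ (h 0)) (sum-last n (h ∘ suc))) (sym (+-assoc (h 0) _ _))

  sum-reverse : ∀ n (h : ℕ → ℤ) → sumBelow n h ≡ sumBelow n (λ k → h (n ∸ suc k))
  sum-reverse zero    h = refl
  sum-reverse (suc n) h = begin
    h 0 + sumBelow n (h ∘ suc)                       ≡⟨ cong (_+_ (h 0)) (sum-reverse n (h ∘ suc)) ⟩
    h 0 + sumBelow n (λ k → h (suc (n ∸ suc k)))     ≡⟨ cong (_+_ (h 0)) (sum-cong n (cong h ∘ ℕ.+-∸-assoc 1)) ⟨
    h 0 + sumBelow n (λ k → h (n ∸ k))               ≡⟨ +-comm (h 0) _ ⟩
    sumBelow n (λ k → h (n ∸ k)) + h 0               ≡⟨ cong (λ l → sumBelow n (λ k → h (n ∸ k)) + h l) (ℕ.n∸n≡0 n) ⟨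
    sumBelow n (λ k → h (n ∸ k)) + h (n ∸ n)         ≡⟨ sum-last n (λ k → h (n ∸ k)) ⟨
    sumBelow (suc n) (λ k → h (n ∸ k))               ∎
    where open ≡-Reasoning

  infix 4 _≐_
  _≐_ : Ser → Ser → Set
  f ≐ g = ∀ i j → f i j ≡ g i j

  -- (f ⊗ g) i j is, definitionally, Σ² i j (λ a b → f a b * g (i ∸ a) (j ∸ b)).
  Σ² : ℕ → ℕ → (ℕ → ℕ → ℤ) → ℤ
  Σ² i j T = sumBelow (suc i) λ a → sumBelow (suc j) (T a)

  Σ²-cong : ∀ i j {S T : ℕ → ℕ → ℤ} → (∀ {a b} → a ≤ i → b ≤ j → S a b ≡ T a b) → Σ² i j S ≡ Σ² i j T
  Σ²-cong i j S≡T = sum-cong (suc i) λ a<1+i → sum-cong (suc j) λ b<1+j → S≡T (ℕ.≤-pred a<1+i) (ℕ.≤-pred b<1+j)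

  Σ²-zero : ∀ i j {T : ℕ → ℕ → ℤ} → (∀ {a b} → a ≤ i → b ≤ j → T a b ≡ 0ℤ) → Σ² i j T ≡ 0ℤ
  Σ²-zero i j T≡0 = sum-zero (suc i) λ a<1+i → sum-zero (suc j) λ b<1+j → T≡0 (ℕ.≤-pred a<1+i) (ℕ.≤-pred b<1+j)

  Σ²-single : ∀ {i j a b} {T : ℕ → ℕ → ℤ} → a ≤ i → b ≤ j →
              (∀ {a′ b′} → a′ ≤ i → b′ ≤ j → a′ ≢ a ⊎ b′ ≢ b → T a′ b′ ≡ 0ℤ) → Σ² i j T ≡ T a b
  Σ²-single {i} {j} a≤i b≤j T≡0 = trans
    (sum-single (s≤s a≤i) λ a′<1+i a′≢a → sum-zero (suc j) λ b′<1+j → T≡0 (ℕ.≤-pred a′<1+i) (ℕ.≤-pred b′<1+j) (inj₁ a′≢a))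
    (sum-single (s≤s b≤j) λ b′<1+j b′≢b → T≡0 a≤i (ℕ.≤-pred b′<1+j) (inj₂ b′≢b))

  Σ²-+ : ∀ i j (S T : ℕ → ℕ → ℤ) → Σ² i j (λ a b → S a b + T a b) ≡ Σ² i j S + Σ² i j T
  Σ²-+ i j S T = trans (sum-cong (suc i) λ {a} _ → sum-+ (suc j) (S a) (T a))
                       (sum-+ (suc i) (λ a → sumBelow (suc j) (S a)) (λ a → sumBelow (suc j) (T a)))

  Σ²-neg : ∀ i j (T : ℕ → ℕ → ℤ) → Σ² i j (λ a b → - T a b) ≡ - Σ² i j T
  Σ²-neg i j T = trans (sum-cong (suc i) λ {a} _ → sum-neg (suc j) (T a)) (sum-neg (suc i) (λ a → sumBelow (suc j) (T a)))

  ⊗-cong : ∀ {f f′ g g′} → f ≐ f′ → g ≐ g′ → f ⊗ g ≐ f′ ⊗ g′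
  ⊗-cong f≐f′ g≐g′ i j = Σ²-cong i j λ {a} {b} _ _ → cong₂ _*_ (f≐f′ a b) (g≐g′ (i ∸ a) (j ∸ b))

  ⊗-congʳ : ∀ f {g g′} → g ≐ g′ → f ⊗ g ≐ f ⊗ g′
  ⊗-congʳ f = ⊗-cong {f} {f} (λ _ _ → refl)

  ⊗-congˡ : ∀ {f f′} g → f ≐ f′ → f ⊗ g ≐ f′ ⊗ g
  ⊗-congˡ g f≐f′ = ⊗-cong f≐f′ (λ _ _ → refl)

  ⊗-comm : ∀ f g → f ⊗ g ≐ g ⊗ f
  ⊗-comm f g i j =
    trans (sum-reverse (suc i) (λ a → sumBelow (suc j) λ b → f a b * g (i ∸ a) (j ∸ b))) (sum-cong (suc i) λ {a} a<1+i →
    trans (sum-reverse (suc j) (λ b → f (i ∸ a) b * g (i ∸ (i ∸ a)) (j ∸ b))) (sum-cong (suc j) λ {b} b<1+j →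
    trans (cong₂ (λ x y → f (i ∸ a) (j ∸ b) * g x y) (ℕ.m∸[m∸n]≡n (ℕ.≤-pred a<1+i)) (ℕ.m∸[m∸n]≡n (ℕ.≤-pred b<1+j)))
          (*-comm (f (i ∸ a) (j ∸ b)) (g a b))))

  ⊗-distribˡ-⊕ : ∀ f g h → f ⊗ (g ⊕ h) ≐ (f ⊗ g) ⊕ (f ⊗ h)
  ⊗-distribˡ-⊕ f g h i j = trans
    (Σ²-cong i j λ {a} {b} _ _ → *-distribˡ-+ (f a b) (g (i ∸ a) (j ∸ b)) (h (i ∸ a) (j ∸ b)))
    (Σ²-+ i j (λ a b → f a b * g (i ∸ a) (j ∸ b)) (λ a b → f a b * h (i ∸ a) (j ∸ b)))

  ⊗-distribʳ-⊕ : ∀ f g h → (g ⊕ h) ⊗ f ≐ (g ⊗ f) ⊕ (h ⊗ f)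
  ⊗-distribʳ-⊕ f g h i j = trans
    (Σ²-cong i j λ {a} {b} _ _ → *-distribʳ-+ (f (i ∸ a) (j ∸ b)) (g a b) (h a b))
    (Σ²-+ i j (λ a b → g a b * f (i ∸ a) (j ∸ b)) (λ a b → h a b * f (i ∸ a) (j ∸ b)))

  ⊗-negʳ : ∀ f g → f ⊗ negS g ≐ negS (f ⊗ g)
  ⊗-negʳ f g i j = trans
    (Σ²-cong i j λ {a} {b} _ _ → sym (neg-distribʳ-* (f a b) (g (i ∸ a) (j ∸ b))))
    (Σ²-neg i j (λ a b → f a b * g (i ∸ a) (j ∸ b)))

  ≡ᵇ-true : ∀ {m n} → m ≡ n → (m ≡ᵇ n) ≡ true
  ≡ᵇ-true {m} {n} = dec-true (m ℕ.≟ n)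

  ≡ᵇ-false : ∀ {m n} → m ≢ n → (m ≡ᵇ n) ≡ false
  ≡ᵇ-false {m} {n} = dec-false (m ℕ.≟ n)

  mono-at : ∀ c a b → mono c a b a b ≡ c
  mono-at c a b = cong₂ (λ x y → if x ∧ y then c else 0ℤ) (≡ᵇ-true {a} refl) (≡ᵇ-true {b} refl)

  mono-off : ∀ c a b i j → i ≢ a ⊎ j ≢ b → mono c a b i j ≡ 0ℤ
  mono-off c a b i j (inj₁ i≢a) = cong (λ x → if x ∧ (j ≡ᵇ b) then c else 0ℤ) (≡ᵇ-false i≢a)
  mono-off c a b i j (inj₂ j≢b) =
    cong (λ x → if x then c else 0ℤ) (trans (cong ((i ≡ᵇ a) ∧_) (≡ᵇ-false j≢b)) (∧-zeroʳ (i ≡ᵇ a)))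

  mono-⊗-inside : ∀ c f {a b} i j → a ≤ i → b ≤ j → (mono c a b ⊗ f) i j ≡ c * f (i ∸ a) (j ∸ b)
  mono-⊗-inside c f {a} {b} i j a≤i b≤j = trans
    (Σ²-single a≤i b≤j λ {a′} {b′} _ _ off → cong (_* f (i ∸ a′) (j ∸ b′)) (mono-off c a b a′ b′ off))
    (cong (_* f (i ∸ a) (j ∸ b)) (mono-at c a b))

  mono-⊗-outside : ∀ c f {a b} i j → i < a ⊎ j < b → (mono c a b ⊗ f) i j ≡ 0ℤ
  mono-⊗-outside c f {a} {b} i j outside = Σ²-zero i j λ {a′} {b′} a′≤i b′≤j →
    cong (_* f (i ∸ a′) (j ∸ b′)) (mono-off c a b a′ b′ (Data.Sum.map (λ i<a → ℕ.<⇒≢ (ℕ.≤-<-trans a′≤i i<a))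
                                                           (λ j<b → ℕ.<⇒≢ (ℕ.≤-<-trans b′≤j j<b)) outside))

  ⊗-identityʳ : ∀ f → f ⊗ oneS ≐ f
  ⊗-identityʳ f i j = trans (⊗-comm f oneS i j) (trans (mono-⊗-inside 1ℤ f i j z≤n z≤n) (*-identityˡ (f i j)))

  ⊗-zeroʳ : ∀ f → f ⊗ zeroS ≐ zeroS
  ⊗-zeroʳ f i j = Σ²-zero i j λ {a} {b} _ _ → *-zeroʳ (f a b)

  x⊗-suc : ∀ f i j → (xS ⊗ f) (suc i) j ≡ f i j
  x⊗-suc f i j = trans (mono-⊗-inside 1ℤ f (suc i) j (s≤s z≤n) z≤n) (*-identityˡ (f i j))

  x⊗-zero : ∀ f j → (xS ⊗ f) 0 j ≡ 0ℤ
  x⊗-zero f j = mono-⊗-outside 1ℤ f {1} {0} 0 j (inj₁ z<s)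

  y⊗-suc : ∀ f i j → (yS ⊗ f) i (suc j) ≡ f i j
  y⊗-suc f i j = trans (mono-⊗-inside 1ℤ f i (suc j) z≤n (s≤s z≤n)) (*-identityˡ (f i j))

  y⊗-zero : ∀ f i → (yS ⊗ f) i 0 ≡ 0ℤ
  y⊗-zero f i = mono-⊗-outside 1ℤ f {0} {1} i 0 (inj₂ z<s)

  x^n≐mono : ∀ n → xS ^S n ≐ mono 1ℤ n 0
  x^n≐mono zero    i       j = refl
  x^n≐mono (suc n) zero    j = trans (⊗-congʳ xS (x^n≐mono n) 0 j) (x⊗-zero (mono 1ℤ n 0) j)
  x^n≐mono (suc n) (suc i) j = trans (⊗-congʳ xS (x^n≐mono n) (suc i) j) (x⊗-suc (mono 1ℤ n 0) i j)

  y^n≐mono : ∀ n → yS ^S n ≐ mono 1ℤ 0 n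
  y^n≐mono zero    i j       = refl
  y^n≐mono (suc n) i zero    = trans (⊗-congʳ yS (y^n≐mono n) i 0)
    (trans (y⊗-zero (mono 1ℤ 0 n) i) (sym (mono-off 1ℤ 0 (suc n) i 0 (inj₂ λ ()))))
  y^n≐mono (suc n) i (suc j) = trans (⊗-congʳ yS (y^n≐mono n) i (suc j)) (trans (y⊗-suc (mono 1ℤ 0 n) i j) (shift i))
    where shift : ∀ i → mono 1ℤ 0 n i j ≡ mono 1ℤ 0 (suc n) i (suc j)
          shift zero    = refl
          shift (suc i) = refl

  binomial : ℕ → Ser
  binomial m i j = if i ℕ.+ j ≡ᵇ m then + (m C i) else 0ℤ

  binomial-on : ∀ {m} i j → i ℕ.+ j ≡ m → binomial m i j ≡ + (m C i)
  binomial-on {m} i j i+j≡m = cong (λ x → if x then + (m C i) else 0ℤ) (≡ᵇ-true i+j≡m)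

  binomial-off : ∀ {m} i j → i ℕ.+ j ≢ m → binomial m i j ≡ 0ℤ
  binomial-off {m} i j i+j≢m = cong (λ x → if x then + (m C i) else 0ℤ) (≡ᵇ-false i+j≢m)

  [x+y]^m≐binomial : ∀ m → (xS ⊕ yS) ^S m ≐ binomial m
  [x+y]^m≐binomial zero zero    zero    = refl
  [x+y]^m≐binomial zero zero    (suc j) = refl
  [x+y]^m≐binomial zero (suc i) j       = refl
  [x+y]^m≐binomial (suc m) i j = begin
    ((xS ⊕ yS) ⊗ ((xS ⊕ yS) ^S m)) i j          ≡⟨ ⊗-congʳ (xS ⊕ yS) ([x+y]^m≐binomial m) i j ⟩
    ((xS ⊕ yS) ⊗ binomial m) i j                 ≡⟨ ⊗-distribʳ-⊕ (binomial m) xS yS i j ⟩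
    (xS ⊗ binomial m) i j + (yS ⊗ binomial m) i j ≡⟨ pascal i j ⟩
    binomial (suc m) i j                          ∎
    where
    open ≡-Reasoning
    pascal : ∀ i j → (xS ⊗ binomial m) i j + (yS ⊗ binomial m) i j ≡ binomial (suc m) i j
    pascal zero zero = cong₂ _+_ (x⊗-zero (binomial m) 0) (y⊗-zero (binomial m) 0)
    pascal zero (suc j) =
      trans (cong₂ _+_ (x⊗-zero (binomial m) (suc j)) (y⊗-suc (binomial m) 0 j)) (+-identityˡ (binomial m 0 j))
    pascal (suc i) zero =
      trans (cong₂ _+_ (x⊗-suc (binomial m) i 0) (y⊗-zero (binomial m) (suc i))) (trans (+-identityʳ _) edge)
      where
      edge : binomial m i 0 ≡ binomial (suc m) (suc i) 0
      edge with i ℕ.+ 0 ℕ.≟ m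
      ... | no  i≢m = trans (binomial-off i 0 i≢m) (sym (binomial-off (suc i) 0 (i≢m ∘ ℕ.suc-injective)))
      ... | yes i≡m = trans (binomial-on i 0 i≡m) (sym (trans (binomial-on (suc i) 0 (cong suc i≡m)) (cong +_ (begin
        suc m C suc i          ≡⟨ nCk+nC[k+1]≡[n+1]C[k+1] m i ⟨
        m C i ℕ.+ m C suc i    ≡⟨ cong (m C i ℕ.+_) (k>n⇒nCk≡0 (s≤s (ℕ.≤-reflexive (sym (trans (sym (ℕ.+-identityʳ i)) i≡m))))) ⟩
        m C i ℕ.+ 0            ≡⟨ ℕ.+-identityʳ (m C i) ⟩
        m C i                  ∎))))
    pascal (suc i) (suc j) =
      trans (cong₂ _+_ (x⊗-suc (binomial m) i (suc j)) (y⊗-suc (binomial m) (suc i) j)) inner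
      where
      inner : binomial m i (suc j) + binomial m (suc i) j ≡ binomial (suc m) (suc i) (suc j)
      inner with i ℕ.+ suc j ℕ.≟ m
      ... | no  ≢m = trans (cong₂ _+_ (binomial-off i (suc j) ≢m) (binomial-off (suc i) j (≢m ∘ trans (ℕ.+-suc i j))))
                           (sym (binomial-off (suc i) (suc j) (≢m ∘ ℕ.suc-injective)))
      ... | yes ≡m = trans (cong₂ _+_ (binomial-on i (suc j) ≡m) (binomial-on (suc i) j (trans (sym (ℕ.+-suc i j)) ≡m)))
                           (sym (trans (binomial-on (suc i) (suc j) (cong suc ≡m)) (cong +_ (sym (nCk+nC[k+1]≡[n+1]C[k+1] m i)))))

  IsPoly-zero : IsPoly zeroS
  IsPoly-zero = 0 , λ _ _ _ → refl

  IsPoly-mono : ∀ c a b → IsPoly (mono c a b)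
  IsPoly-mono c a b = suc (a ℕ.+ b) , λ i j a+b<i+j → mono-off c a b i j (off i j a+b<i+j)
    where
    off : ∀ i j → a ℕ.+ b < i ℕ.+ j → i ≢ a ⊎ j ≢ b
    off i j a+b<i+j with i ℕ.≟ a
    ... | no  i≢a  = inj₁ i≢a
    ... | yes refl = inj₂ λ where refl → ℕ.<-irrefl refl a+b<i+j

  IsPoly-⊕ : ∀ {f g} → IsPoly f → IsPoly g → IsPoly (f ⊕ g)
  IsPoly-⊕ (N , f≡0) (N′ , g≡0) = N ℕ.+ N′ , λ i j N+N′≤i+j →
    cong₂ _+_ (f≡0 i j (ℕ.≤-trans (ℕ.m≤m+n N N′) N+N′≤i+j)) (g≡0 i j (ℕ.≤-trans (ℕ.m≤n+m N′ N) N+N′≤i+j))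

  IsPoly-neg : ∀ {f} → IsPoly f → IsPoly (negS f)
  IsPoly-neg (N , f≡0) = N , λ i j N≤i+j → cong -_ (f≡0 i j N≤i+j)

  IsPoly-⊗ : ∀ {f g} → IsPoly f → IsPoly g → IsPoly (f ⊗ g)
  IsPoly-⊗ {f} {g} (N , f≡0) (N′ , g≡0) = N ℕ.+ N′ , λ i j N+N′≤i+j → Σ²-zero i j (term N+N′≤i+j)
    where
    term : ∀ {i j a b} → N ℕ.+ N′ ≤ i ℕ.+ j → a ≤ i → b ≤ j → f a b * g (i ∸ a) (j ∸ b) ≡ 0ℤ
    term {i} {j} {a} {b} N+N′≤i+j a≤i b≤j with N ℕ.≤? a ℕ.+ b
    ... | yes N≤a+b = cong (_* g (i ∸ a) (j ∸ b)) (f≡0 a b N≤a+b)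
    ... | no  N≰a+b = trans (cong (f a b *_) (g≡0 (i ∸ a) (j ∸ b) N′≤rest)) (*-zeroʳ (f a b))
      where
      open ℕ.≤-Reasoning
      N′≤rest : N′ ≤ (i ∸ a) ℕ.+ (j ∸ b)
      N′≤rest = ℕ.+-cancelˡ-≤ (a ℕ.+ b) N′ _ (begin
        a ℕ.+ b ℕ.+ N′                           ≤⟨ ℕ.+-monoˡ-≤ N′ (ℕ.<⇒≤ (ℕ.≰⇒> N≰a+b)) ⟩
        N ℕ.+ N′                                 ≤⟨ N+N′≤i+j ⟩
        i ℕ.+ j                                  ≡⟨ cong₂ ℕ._+_ (ℕ.m+[n∸m]≡n a≤i) (ℕ.m+[n∸m]≡n b≤j) ⟨
        (a ℕ.+ (i ∸ a)) ℕ.+ (b ℕ.+ (j ∸ b))      ≡⟨ ℕ+.interchange a (i ∸ a) b (j ∸ b) ⟩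
        a ℕ.+ b ℕ.+ ((i ∸ a) ℕ.+ (j ∸ b))        ∎)

  shift : ℕ → ℕ → Ser → Ser
  shift a b f i j = f (i ℕ.+ a) (j ℕ.+ b)

  IsPoly-shift : ∀ a b {f} → IsPoly f → IsPoly (shift a b f)
  IsPoly-shift a b (N , f≡0) = N , λ i j N≤i+j →
    f≡0 (i ℕ.+ a) (j ℕ.+ b) (ℕ.≤-trans N≤i+j (ℕ.+-mono-≤ (ℕ.m≤m+n i a) (ℕ.m≤m+n j b)))

  IsPoly-binomial : ∀ m → IsPoly (binomial m)
  IsPoly-binomial m = suc m , λ i j m<i+j → binomial-off i j λ i+j≡m → ℕ.<-irrefl (sym i+j≡m) m<i+j

  IsPoly-support : ∀ {f g} → (∀ i j → f i j ≡ 0ℤ ⊎ f i j ≡ g i j) → IsPoly g → IsPoly f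
  IsPoly-support f≡0∨g (N , g≡0) = N , λ i j N≤i+j → Data.Sum.[ id , (λ f≡g → trans f≡g (g≡0 i j N≤i+j)) ] (f≡0∨g i j)

  -- ψ (a , b , m) = (ψ₁ a m , ψ₂ a m) definitionally.
  ψ₁ ψ₂ : ℕ → ℕ → Ser
  ψ₁ a m = sumRange a (suc m) (binTerm m)
  ψ₂ a m = sumRange 0 a (binTerm m)

  binTerm-off : ∀ m {k i} j → k ≢ i → binTerm m k i j ≡ 0ℤ
  binTerm-off m {k} {i} j k≢i = mono-off (+ (m C k)) k (m ∸ k) i j (inj₁ (k≢i ∘ sym))

  binTerm-beyond : ∀ {m k} i j → m < k → binTerm m k i j ≡ 0ℤ
  binTerm-beyond {m} {k} i j m<k =
    trans (cong (λ c → mono (+ c) k (m ∸ k) i j) (k>n⇒nCk≡0 m<k)) (if-eta ((i ≡ᵇ k) ∧ (j ≡ᵇ m ∸ k)))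

  binTerm-diag : ∀ m i j → binTerm m i i j ≡ binomial m i j
  binTerm-diag m i j with j ℕ.≟ m ∸ i
  ... | no j≢m∸i = trans (mono-off (+ (m C i)) i (m ∸ i) i j (inj₂ j≢m∸i))
    (sym (binomial-off i j λ i+j≡m → j≢m∸i (trans (sym (ℕ.m+n∸m≡n i j)) (cong (_∸ i) i+j≡m))))
  ... | yes refl with i ℕ.≤? m
  ...   | yes i≤m = trans (mono-at (+ (m C i)) i (m ∸ i)) (sym (binomial-on i (m ∸ i) (ℕ.m+[n∸m]≡n i≤m)))
  ...   | no  i≰m = trans (binTerm-beyond i (m ∸ i) (ℕ.≰⇒> i≰m))
    (sym (binomial-off i (m ∸ i) λ i+[m∸i]≡m → i≰m (subst (i ≤_) i+[m∸i]≡m (ℕ.m≤m+n i (m ∸ i)))))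

  ψ₁-< : ∀ {a} m {i} j → i < a → ψ₁ a m i j ≡ 0ℤ
  ψ₁-< {a} m {i} j i<a = sum-zero (suc m ∸ a) λ {k} _ →
    binTerm-off m j λ a+k≡i → ℕ.<-irrefl (sym a+k≡i) (ℕ.<-≤-trans i<a (ℕ.m≤m+n a k))

  ψ₁-≥ : ∀ {a} m {i} j → a ≤ i → ψ₁ a m i j ≡ binomial m i j
  ψ₁-≥ {a} m {i} j a≤i with i ℕ.≤? m
  ... | yes i≤m = trans
    (sum-single (ℕ.∸-monoˡ-< (s≤s i≤m) a≤i) λ {k} _ k≢i∸a → binTerm-off m j λ a+k≡i → k≢i∸a (begin
      k               ≡⟨ ℕ.m+n∸m≡n a k ⟨
      a ℕ.+ k ∸ a     ≡⟨ cong (_∸ a) a+k≡i ⟩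
      i ∸ a           ∎))
    (trans (cong (λ k → binTerm m k i j) (ℕ.m+[n∸m]≡n a≤i)) (binTerm-diag m i j))
    where open ≡-Reasoning
  ... | no  i≰m = trans
    (sum-zero (suc m ∸ a) λ {k} _ → beyond-or-off (a ℕ.+ k))
    (sym (binomial-off i j λ i+j≡m → i≰m (subst (i ≤_) i+j≡m (ℕ.m≤m+n i j))))
    where
    beyond-or-off : ∀ k → binTerm m k i j ≡ 0ℤ
    beyond-or-off k with k ℕ.≟ i
    ... | yes refl = binTerm-beyond i j (ℕ.≰⇒> i≰m)
    ... | no  k≢i  = binTerm-off m j k≢i

  ψ₂-< : ∀ {a} m {i} j → i < a → ψ₂ a m i j ≡ binTerm m i i j
  ψ₂-< {a} m {i} j i<a = sum-single i<a λ _ k≢i → binTerm-off m j k≢i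

  ψ₂-≥ : ∀ {a} m {i} j → a ≤ i → ψ₂ a m i j ≡ 0ℤ
  ψ₂-≥ {a} m {i} j a≤i = sum-zero a λ k<a → binTerm-off m j λ k≡i → ℕ.<-irrefl k≡i (ℕ.<-≤-trans k<a a≤i)

  ψ₁⊕ψ₂≐binomial : ∀ a m → ψ₁ a m ⊕ ψ₂ a m ≐ binomial m
  ψ₁⊕ψ₂≐binomial a m i j with a ℕ.≤? i
  ... | yes a≤i = trans (cong₂ _+_ (ψ₁-≥ m j a≤i) (ψ₂-≥ m j a≤i)) (+-identityʳ _)
  ... | no  a≰i = trans (cong₂ _+_ (ψ₁-< m j (ℕ.≰⇒> a≰i)) (ψ₂-< m j (ℕ.≰⇒> a≰i))) (trans (+-identityˡ _) (binTerm-diag m i j))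

  IsPoly-ψ₁ : ∀ a m → IsPoly (ψ₁ a m)
  IsPoly-ψ₁ a m = IsPoly-support support (IsPoly-binomial m)
    where
    support : ∀ i j → ψ₁ a m i j ≡ 0ℤ ⊎ ψ₁ a m i j ≡ binomial m i j
    support i j with a ℕ.≤? i
    ... | yes a≤i = inj₂ (ψ₁-≥ m j a≤i)
    ... | no  a≰i = inj₁ (ψ₁-< m j (ℕ.≰⇒> a≰i))

  IsPoly-ψ₂ : ∀ a m → IsPoly (ψ₂ a m)
  IsPoly-ψ₂ a m = IsPoly-support support (IsPoly-binomial m)
    where
    support : ∀ i j → ψ₂ a m i j ≡ 0ℤ ⊎ ψ₂ a m i j ≡ binomial m i j
    support i j with a ℕ.≤? i
    ... | yes a≤i = inj₁ (ψ₂-≥ m j a≤i)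
    ... | no  a≰i = inj₂ (trans (ψ₂-< m j (ℕ.≰⇒> a≰i)) (binTerm-diag m i j))

  [x+y]^m⊗h≐h⊗ψ₁⊕h⊗ψ₂ : ∀ a m h → ((xS ⊕ yS) ^S m) ⊗ h ≐ (h ⊗ ψ₁ a m) ⊕ (h ⊗ ψ₂ a m)
  [x+y]^m⊗h≐h⊗ψ₁⊕h⊗ψ₂ a m h i j = begin
    (((xS ⊕ yS) ^S m) ⊗ h) i j                    ≡⟨ ⊗-comm ((xS ⊕ yS) ^S m) h i j ⟩
    (h ⊗ ((xS ⊕ yS) ^S m)) i j                    ≡⟨ ⊗-congʳ h (λ i j → trans ([x+y]^m≐binomial m i j) (sym (ψ₁⊕ψ₂≐binomial a m i j))) i j ⟩
    (h ⊗ (ψ₁ a m ⊕ ψ₂ a m)) i j                   ≡⟨ ⊗-distribˡ-⊕ h (ψ₁ a m) (ψ₂ a m) i j ⟩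
    (h ⊗ ψ₁ a m) i j + (h ⊗ ψ₂ a m) i j           ∎
    where open ≡-Reasoning

module SeriesModP (p : ℕ) where

  open import Data.Unit using (tt)
  open import Data.Nat as ℕ using (zero; s≤s; z<s; _∸_)
  import Data.Nat.Properties as ℕ
  open import Data.Integer using (ℤ; 0ℤ; 1ℤ; _+_; _*_)
  open import Data.Integer.Properties using (*-identityˡ; *-identityʳ; *-zeroʳ; +-identityˡ)
  open import Data.Product using (_,_)
  open import Data.Sum using (inj₁; inj₂)
  open import Function.Base using (_∘_)
  open import Function.Bundles using (mk⇔; Equivalence)
  open import Relation.Nullary using (yes; no)
  open import Relation.Binary.PropositionalEquality using (_≢_; refl; sym; trans; cong; cong₂)
  open Series
  open Congruence p

  sum-cong-≈ : ∀ n {h h′ : ℕ → ℤ} → (∀ {k} → k < n → h k ≈ h′ k) → sumBelow n h ≈ sumBelow n h′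
  sum-cong-≈ zero    _     = ≈-refl
  sum-cong-≈ (suc n) h≈h′ = +-cong (h≈h′ z<s) (sum-cong-≈ n (h≈h′ ∘ s≤s))

  infix 4 _≈ˢ_
  _≈ˢ_ : Ser → Ser → Set
  f ≈ˢ g = ∀ i j → f i j ≈ g i j

  ≈ˢ⇔≈[p] : ∀ f g → f ≈ˢ g ⇔ f ≈[ p ] g
  ≈ˢ⇔≈[p] f g = mk⇔ (λ f≈g i j → Equivalence.to (≈⇔≡[p] (f i j) (g i j)) (f≈g i j))
                    (λ f≈g i j → Equivalence.from (≈⇔≡[p] (f i j) (g i j)) (f≈g i j))

  sum-vanishes : ∀ n {h : ℕ → ℤ} → (∀ {k} → k < n → h k ≈ 0ℤ) → sumBelow n h ≈ 0ℤ
  sum-vanishes n h≈0 = ≈-trans (sum-cong-≈ n h≈0) (≈-reflexive (sum-zero n λ _ → refl))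

  VanishesOn : (ℕ → ℕ → Set) → Ser → Set
  VanishesOn R f = ∀ i j → R i j → f i j ≈ 0ℤ

  ⊗-vanishesOn : ∀ {R} f {g} → (∀ {i j} a b → R i j → R (i ∸ a) (j ∸ b)) → VanishesOn R g → VanishesOn R (f ⊗ g)
  ⊗-vanishesOn f {g} R-closed g≈0 i j Rij =
    sum-vanishes (suc i) λ {a} _ → sum-vanishes (suc j) λ {b} _ →
      ≈-trans (*-cong (≈-refl {f a b}) (g≈0 (i ∸ a) (j ∸ b) (R-closed a b Rij))) (≈-reflexive (*-zeroʳ (f a b)))

  ≈0-⊗ : ∀ {f} g → f ≈ˢ zeroS → f ⊗ g ≈ˢ zeroS
  ≈0-⊗ {f} g f≈0 i j = ≈-trans (≈-reflexive (⊗-comm f g i j)) (⊗-vanishesOn g (λ _ _ _ → tt) (λ i j _ → f≈0 i j) i j tt)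

  Outside : ℕ → ℕ → ℕ → ℕ → Set
  Outside a b i j = i < a ⊎ j < b

  outside? : ∀ a b i j → Outside a b i j ⊎ (a ≤ i × b ≤ j)
  outside? a b i j with a ℕ.≤? i | b ℕ.≤? j
  ... | yes a≤i | yes b≤j = inj₂ (a≤i , b≤j)
  ... | no  a≰i | _       = inj₁ (inj₁ (ℕ.≰⇒> a≰i))
  ... | yes _   | no  b≰j = inj₁ (inj₂ (ℕ.≰⇒> b≰j))

  mono-factor : ∀ {a b f} → VanishesOn (Outside a b) f → f ≈ˢ mono 1ℤ a b ⊗ shift a b f
  mono-factor {a} {b} {f} f≈0 i j with outside? a b i j
  ... | inj₁ out = ≈-trans (f≈0 i j out) (≈-reflexive (sym (mono-⊗-outside 1ℤ (shift a b f) i j out)))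
  ... | inj₂ (a≤i , b≤j) = ≈-reflexive (sym (trans (mono-⊗-inside 1ℤ (shift a b f) i j a≤i b≤j)
          (trans (*-identityˡ _) (cong₂ f (ℕ.m∸n+n≡m a≤i) (ℕ.m∸n+n≡m b≤j)))))

  ⊗-mono-cancel : ∀ {a b} B → B ⊗ mono 1ℤ a b ≈ˢ zeroS → B ≈ˢ zeroS
  ⊗-mono-cancel {a} {b} B B⊗M≈0 i j = begin
    B i j                                   ≡⟨ cong₂ B (ℕ.m+n∸n≡m i a) (ℕ.m+n∸n≡m j b) ⟨
    B (i ℕ.+ a ∸ a) (j ℕ.+ b ∸ b)           ≡⟨ *-identityˡ _ ⟨
    1ℤ * B (i ℕ.+ a ∸ a) (j ℕ.+ b ∸ b)      ≡⟨ mono-⊗-inside 1ℤ B (i ℕ.+ a) (j ℕ.+ b) (ℕ.m≤n+m a i) (ℕ.m≤n+m b j) ⟨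
    (mono 1ℤ a b ⊗ B) (i ℕ.+ a) (j ℕ.+ b)   ≡⟨ ⊗-comm (mono 1ℤ a b) B (i ℕ.+ a) (j ℕ.+ b) ⟩
    (B ⊗ mono 1ℤ a b) (i ℕ.+ a) (j ℕ.+ b)   ≈⟨ B⊗M≈0 (i ℕ.+ a) (j ℕ.+ b) ⟩
    0ℤ                                      ∎
    where open import Relation.Binary.Reasoning.Setoid ≈-setoid

  mono-∣⇔ : ∀ {a b f} → IsPoly f → Divides p (mono 1ℤ a b) f ⇔ VanishesOn (Outside a b) f
  mono-∣⇔ {a} {b} {f} f-poly = mk⇔ to from
    where
    to : Divides p (mono 1ℤ a b) f → VanishesOn (Outside a b) f
    to (q , _ , f≈mq) i j out =
      ≈-trans (Equivalence.from (≈ˢ⇔≈[p] f (mono 1ℤ a b ⊗ q)) f≈mq i j) (≈-reflexive (mono-⊗-outside 1ℤ q i j out))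
    from : VanishesOn (Outside a b) f → Divides p (mono 1ℤ a b) f
    from f≈0 = shift a b f , IsPoly-shift a b f-poly , Equivalence.to (≈ˢ⇔≈[p] f _) (mono-factor {a} {b} {f} f≈0)

  Divides-cong : ∀ {g g′ f} → g ≐ g′ → Divides p g f → Divides p g′ f
  Divides-cong {g} {g′} {f} g≐g′ (q , q-poly , f≈gq) =
    q , q-poly , Equivalence.to (≈ˢ⇔≈[p] f (g′ ⊗ q)) λ i j →
      ≈-trans (Equivalence.from (≈ˢ⇔≈[p] f (g ⊗ q)) f≈gq i j) (≈-reflexive (⊗-congˡ q g≐g′ i j))

  x^n∣⇔ : ∀ {n f} → IsPoly f → Divides p (xS ^S n) f ⇔ VanishesOn (λ i _ → i < n) f
  x^n∣⇔ {n} {f} f-poly = mk⇔ to from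
    where
    to : Divides p (xS ^S n) f → VanishesOn (λ i _ → i < n) f
    to x^n∣f i j i<n = Equivalence.to (mono-∣⇔ {n} {0} f-poly) (Divides-cong {f = f} (x^n≐mono n) x^n∣f) i j (inj₁ i<n)
    from : VanishesOn (λ i _ → i < n) f → Divides p (xS ^S n) f
    from f≈0 = Divides-cong {f = f} (λ i j → sym (x^n≐mono n i j)) (Equivalence.from (mono-∣⇔ {n} {0} f-poly) λ where
      i j (inj₁ i<n) → f≈0 i j i<n)

  y^n∣⇔ : ∀ {n f} → IsPoly f → Divides p (yS ^S n) f ⇔ VanishesOn (λ _ j → j < n) f
  y^n∣⇔ {n} {f} f-poly = mk⇔ to from
    where
    to : Divides p (yS ^S n) f → VanishesOn (λ _ j → j < n) f
    to y^n∣f i j j<n = Equivalence.to (mono-∣⇔ {0} {n} f-poly) (Divides-cong {f = f} (y^n≐mono n) y^n∣f) i j (inj₂ j<n)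
    from : VanishesOn (λ _ j → j < n) f → Divides p (yS ^S n) f
    from f≈0 = Divides-cong {f = f} (λ i j → sym (y^n≐mono n i j)) (Equivalence.from (mono-∣⇔ {0} {n} f-poly) λ where
      i j (inj₂ j<n) → f≈0 i j j<n)

  -- The coefficient of y^m in (x + y)^m is 1, so the lowest row of A survives in A ⊗ (x + y)^m.
  binomial-cancel : ∀ m A → A ⊗ binomial m ≈ˢ zeroS → A ≈ˢ zeroS
  binomial-cancel m A A⊗B≈0 i j = rows (suc i) (ℕ.n<1+n i) j
    where
    B : Ser
    B = binomial m
    lowest : ∀ i j → (∀ {i′} → i′ < i → ∀ j′ → A i′ j′ ≈ 0ℤ) → (A ⊗ B) i (j ℕ.+ m) ≈ A i j
    lowest i j below = begin
      (A ⊗ B) i (j ℕ.+ m)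
        ≡⟨ sum-last i (λ a → sumBelow (suc (j ℕ.+ m)) λ b → A a b * B (i ∸ a) (j ℕ.+ m ∸ b)) ⟩
      sumBelow i (λ a → sumBelow (suc (j ℕ.+ m)) λ b → A a b * B (i ∸ a) (j ℕ.+ m ∸ b))
        + sumBelow (suc (j ℕ.+ m)) (λ b → A i b * B (i ∸ i) (j ℕ.+ m ∸ b))
        ≈⟨ +-cong (sum-vanishes i λ {a} a<i → sum-vanishes (suc (j ℕ.+ m)) λ {b} _ →
                    *-cong (below a<i b) (≈-refl {B (i ∸ a) (j ℕ.+ m ∸ b)}))
                  (≈-reflexive (sum-single (s≤s (ℕ.m≤m+n j m)) λ {b} b<1+j+m b≢j →
                    trans (cong (A i b *_) (off (ℕ.≤-pred b<1+j+m) b≢j)) (*-zeroʳ (A i b)))) ⟩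
      0ℤ + A i j * B (i ∸ i) (j ℕ.+ m ∸ j)
        ≡⟨ trans (+-identityˡ _) (cong (A i j *_) at) ⟩
      A i j * 1ℤ
        ≡⟨ *-identityʳ (A i j) ⟩
      A i j ∎
      where
      open import Relation.Binary.Reasoning.Setoid ≈-setoid
      at : B (i ∸ i) (j ℕ.+ m ∸ j) ≡ 1ℤ
      at = trans (cong₂ B (ℕ.n∸n≡0 i) (ℕ.m+n∸m≡n j m)) (binomial-on 0 m refl)
      off : ∀ {b} → b ≤ j ℕ.+ m → b ≢ j → B (i ∸ i) (j ℕ.+ m ∸ b) ≡ 0ℤ
      off {b} b≤j+m b≢j = trans (cong (λ x → B x (j ℕ.+ m ∸ b)) (ℕ.n∸n≡0 i)) (binomial-off 0 (j ℕ.+ m ∸ b) λ j+m∸b≡m →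
        b≢j (ℕ.+-cancelˡ-≡ m b j (trans (cong (ℕ._+ b) (sym j+m∸b≡m)) (trans (ℕ.m∸n+n≡m b≤j+m) (ℕ.+-comm j m)))))
    rows : ∀ i {i′} → i′ < i → ∀ j → A i′ j ≈ 0ℤ
    rows (suc i) {i′} (s≤s i′≤i) j with ℕ.m≤n⇒m<n∨m≡n i′≤i
    ... | inj₁ i′<i = rows i i′<i j
    ... | inj₂ refl = ≈-trans (≈-sym (lowest i′ j (rows i′))) (A⊗B≈0 i′ (j ℕ.+ m))

module Basis where

  open import Data.Nat as ℕ using (_∸_)
  import Data.Nat.Properties as ℕ
  open import Data.Nat.Combinatorics using (_C_)
  open import Data.Integer using (+_; 0ℤ; 1ℤ; _+_; _-_; -_)
  open import Data.Integer.Properties using (+-inverseˡ)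
  open import Data.Integer.Tactic.RingSolver using (solve-∀)
  open import Data.Product using (_,_)
  open import Data.Sum using (inj₁; inj₂)
  open import Function.Bundles using (mk⇔; Equivalence)
  open import Relation.Nullary using (yes; no)
  open import Relation.Binary.PropositionalEquality using (refl; sym; trans; cong)
  open Series
  open Enumeration using (BinomialsVanish)

  module _ (p a b m : ℕ) where
    open Congruence p
    open SeriesModP p
    open import Relation.Binary.Reasoning.Setoid ≈-setoid

    private
      μ : Mult
      μ = a , b , m
      M : Ser
      M = mono 1ℤ a b

    ψ₁≈0 : VanishesOn (λ i _ → i < a) (ψ₁ a m)
    ψ₁≈0 i j i<a = ≈-reflexive (ψ₁-< m j i<a)

    ψ∈D : VanishesOn (λ _ j → j < b) (ψ₂ a m) → InD p μ (ψ μ)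
    ψ∈D ψ₂≈0 = (IsPoly-ψ₁ a m , IsPoly-ψ₂ a m)
             , Equivalence.from (x^n∣⇔ (IsPoly-ψ₁ a m)) ψ₁≈0
             , Equivalence.from (y^n∣⇔ (IsPoly-ψ₂ a m)) ψ₂≈0
             , oneS , IsPoly-mono 1ℤ 0 0 , Equivalence.to (≈ˢ⇔≈[p] (ψ₁ a m ⊕ ψ₂ a m) _) λ i j → begin
                 ψ₁ a m i j + ψ₂ a m i j                ≡⟨ ψ₁⊕ψ₂≐binomial a m i j ⟩
                 binomial m i j                         ≡⟨ [x+y]^m≐binomial m i j ⟨
                 ((xS ⊕ yS) ^S m) i j                   ≡⟨ ⊗-identityʳ ((xS ⊕ yS) ^S m) i j ⟨
                 (((xS ⊕ yS) ^S m) ⊗ oneS) i j          ∎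

    ψ′∈D : InD p μ (ψ′ μ)
    ψ′∈D = (IsPoly-neg (IsPoly-mono 1ℤ a b) , IsPoly-mono 1ℤ a b)
         , Equivalence.from (x^n∣⇔ (IsPoly-neg (IsPoly-mono 1ℤ a b)))
             (λ i j i<a → ≈-reflexive (cong -_ (mono-off 1ℤ a b i j (inj₁ (ℕ.<⇒≢ i<a)))))
         , Equivalence.from (y^n∣⇔ (IsPoly-mono 1ℤ a b))
             (λ i j j<b → ≈-reflexive (mono-off 1ℤ a b i j (inj₂ (ℕ.<⇒≢ j<b))))
         , zeroS , IsPoly-zero , Equivalence.to (≈ˢ⇔≈[p] (negS M ⊕ M) _) λ i j →
             ≈-reflexive (trans (+-inverseˡ (M i j)) (sym (⊗-zeroʳ ((xS ⊕ yS) ^S m) i j)))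

    -- k = g − h ψ₂ = h ψ₁ − f: the first form is divisible by y^b, the second by x^a.
    span : VanishesOn (λ _ j → j < b) (ψ₂ a m) → ∀ ζ → InD p μ ζ →
           ∃ λ h → ∃ λ B → IsPoly h × IsPoly B × (ζ ≈D[ p ] lin h (ψ μ) B (ψ′ μ))
    span ψ₂≈0 (f , g) ((f-poly , g-poly) , x^a∣f , y^b∣g , h , h-poly , f⊕g≈) =
      h , B , h-poly , B-poly , Equivalence.to (≈ˢ⇔≈[p] f _) f≈ , Equivalence.to (≈ˢ⇔≈[p] g _) g≈
      where
      X Y k B : Ser
      X = h ⊗ ψ₁ a m
      Y = h ⊗ ψ₂ a m
      k = g ⊕ negS Y
      B = shift a b k
      B-poly : IsPoly B
      B-poly = IsPoly-shift a b (IsPoly-⊕ g-poly (IsPoly-neg (IsPoly-⊗ h-poly (IsPoly-ψ₂ a m))))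
      k≈X-f : ∀ i j → k i j ≈ X i j - f i j
      k≈X-f i j = u+v≈x+y⇒v-y≈x-u {f i j} {g i j} {X i j} {Y i j}
        (≈-trans (Equivalence.from (≈ˢ⇔≈[p] (f ⊕ g) _) f⊕g≈ i j) (≈-reflexive ([x+y]^m⊗h≐h⊗ψ₁⊕h⊗ψ₂ a m h i j)))
      k≈0 : VanishesOn (Outside a b) k
      k≈0 i j (inj₁ i<a) = ≈-trans (k≈X-f i j) (+-cong
        (⊗-vanishesOn h (λ a′ _ i<a → ℕ.≤-<-trans (ℕ.m∸n≤m _ a′) i<a) ψ₁≈0 i j i<a)
        (-‿cong (Equivalence.to (x^n∣⇔ f-poly) x^a∣f i j i<a)))
      k≈0 i j (inj₂ j<b) = +-cong
        (Equivalence.to (y^n∣⇔ g-poly) y^b∣g i j j<b)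
        (-‿cong (⊗-vanishesOn h (λ _ b′ j<b → ℕ.≤-<-trans (ℕ.m∸n≤m _ b′) j<b) ψ₂≈0 i j j<b))
      k≈MB : k ≈ˢ M ⊗ B
      k≈MB = mono-factor {a} {b} {k} k≈0
      f≈ : f ≈ˢ X ⊕ (B ⊗ negS M)
      f≈ i j = begin
        f i j                        ≡⟨ l₁ (f i j) (X i j) ⟩
        X i j - (X i j - f i j)      ≈⟨ +-cong (≈-refl {X i j}) (-‿cong (≈-trans (≈-sym (k≈X-f i j)) (k≈MB i j))) ⟩
        X i j - (M ⊗ B) i j          ≡⟨ cong (_+_ (X i j)) (trans (cong -_ (⊗-comm M B i j)) (sym (⊗-negʳ B M i j))) ⟩
        X i j + (B ⊗ negS M) i j     ∎
        where l₁ : ∀ f x → f ≡ x - (x - f)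
              l₁ = solve-∀
      g≈ : g ≈ˢ Y ⊕ (B ⊗ M)
      g≈ i j = begin
        g i j                        ≡⟨ l₁ (g i j) (Y i j) ⟩
        Y i j + k i j                ≈⟨ +-cong (≈-refl {Y i j}) (k≈MB i j) ⟩
        Y i j + (M ⊗ B) i j          ≡⟨ cong (_+_ (Y i j)) (⊗-comm M B i j) ⟩
        Y i j + (B ⊗ M) i j          ∎
        where l₁ : ∀ g y → g ≡ y + (g - y)
              l₁ = solve-∀

    -- The two components add up to A (x+y)^m, so A = 0, and then B x^a y^b = − A ψ₂ = 0.
    independent : ∀ A B → IsPoly A → IsPoly B → lin A (ψ μ) B (ψ′ μ) ≈D[ p ] (zeroS , zeroS) →
                  (A ≈[ p ] zeroS) × (B ≈[ p ] zeroS)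
    independent A B _ _ (E₁′ , E₂′) = Equivalence.to (≈ˢ⇔≈[p] A zeroS) A≈0 , Equivalence.to (≈ˢ⇔≈[p] B zeroS) B≈0
      where
      E₁ : (A ⊗ ψ₁ a m) ⊕ (B ⊗ negS M) ≈ˢ zeroS
      E₁ = Equivalence.from (≈ˢ⇔≈[p] _ zeroS) E₁′
      E₂ : (A ⊗ ψ₂ a m) ⊕ (B ⊗ M) ≈ˢ zeroS
      E₂ = Equivalence.from (≈ˢ⇔≈[p] _ zeroS) E₂′
      A≈0 : A ≈ˢ zeroS
      A≈0 = binomial-cancel m A λ i j → begin
        (A ⊗ binomial m) i j
          ≡⟨ ⊗-congʳ A (λ i j → sym (ψ₁⊕ψ₂≐binomial a m i j)) i j ⟩
        (A ⊗ (ψ₁ a m ⊕ ψ₂ a m)) i j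
          ≡⟨ ⊗-distribˡ-⊕ A (ψ₁ a m) (ψ₂ a m) i j ⟩
        (A ⊗ ψ₁ a m) i j + (A ⊗ ψ₂ a m) i j
          ≡⟨ l₁ ((A ⊗ ψ₁ a m) i j) ((A ⊗ ψ₂ a m) i j) ((B ⊗ M) i j) ⟩
        ((A ⊗ ψ₁ a m) i j + - (B ⊗ M) i j) + ((A ⊗ ψ₂ a m) i j + (B ⊗ M) i j)
          ≡⟨ cong (λ z → ((A ⊗ ψ₁ a m) i j + z) + ((A ⊗ ψ₂ a m) i j + (B ⊗ M) i j)) (⊗-negʳ B M i j) ⟨
        ((A ⊗ ψ₁ a m) i j + (B ⊗ negS M) i j) + ((A ⊗ ψ₂ a m) i j + (B ⊗ M) i j)
          ≈⟨ +-cong (E₁ i j) (E₂ i j) ⟩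
        0ℤ ∎
        where l₁ : ∀ x y w → x + y ≡ (x + - w) + (y + w)
              l₁ = solve-∀
      B≈0 : B ≈ˢ zeroS
      B≈0 = ⊗-mono-cancel B λ i j → begin
        (B ⊗ M) i j                                           ≡⟨ l₁ ((A ⊗ ψ₂ a m) i j) ((B ⊗ M) i j) ⟩
        ((A ⊗ ψ₂ a m) i j + (B ⊗ M) i j) - (A ⊗ ψ₂ a m) i j   ≈⟨ +-cong (E₂ i j) (-‿cong (≈0-⊗ (ψ₂ a m) A≈0 i j)) ⟩
        0ℤ                                                    ∎
        where l₁ : ∀ y w → w ≡ (y + w) - y
              l₁ = solve-∀

    basis⇔y^b∣ψ₂ : IsBasisD p μ (ψ μ) (ψ′ μ) ⇔ VanishesOn (λ _ j → j < b) (ψ₂ a m)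
    basis⇔y^b∣ψ₂ = mk⇔
      (λ ((_ , _ , y^b∣ψ₂ , _) , _) → Equivalence.to (y^n∣⇔ (IsPoly-ψ₂ a m)) y^b∣ψ₂)
      (λ ψ₂≈0 → ψ∈D ψ₂≈0 , ψ′∈D , span ψ₂≈0 , independent)

    y^b∣ψ₂⇔vanish : VanishesOn (λ _ j → j < b) (ψ₂ a m) ⇔ BinomialsVanish p m a b
    y^b∣ψ₂⇔vanish = mk⇔ to from
      where
      to : VanishesOn (λ _ j → j < b) (ψ₂ a m) → BinomialsVanish p m a b
      to ψ₂≈0 i i<a m∸i<b = Equivalence.to (+n≈0⇔p∣n (m C i)) (begin
        + (m C i)                  ≡⟨ mono-at (+ (m C i)) i (m ∸ i) ⟨
        binTerm m i i (m ∸ i)      ≡⟨ ψ₂-< m (m ∸ i) i<a ⟨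
        ψ₂ a m i (m ∸ i)           ≈⟨ ψ₂≈0 i (m ∸ i) m∸i<b ⟩
        0ℤ                         ∎)
      from : BinomialsVanish p m a b → VanishesOn (λ _ j → j < b) (ψ₂ a m)
      from vanish i j j<b with a ℕ.≤? i
      ... | yes a≤i = ≈-reflexive (ψ₂-≥ m j a≤i)
      ... | no  a≰i with j ℕ.≟ m ∸ i
      ...   | yes refl = ≈-trans (≈-reflexive (trans (ψ₂-< m j (ℕ.≰⇒> a≰i)) (mono-at (+ (m C i)) i j)))
                                 (Equivalence.from (+n≈0⇔p∣n (m C i)) (vanish i (ℕ.≰⇒> a≰i) j<b))
      ...   | no  j≢m∸i = ≈-reflexive (trans (ψ₂-< m j (ℕ.≰⇒> a≰i)) (mono-off (+ (m C i)) i (m ∸ i) i j (inj₂ j≢m∸i)))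

open import Data.Product using (_,_)
open import Data.Sum using (inj₁; inj₂)
open import Function.Bundles using (mk⇔; Equivalence)
open import Function.Construct.Composition using (_⇔-∘_)
open import Relation.Binary.PropositionalEquality using (refl)
open import Data.Nat.Properties using (≤-refl)
open import Data.Nat using (nonTrivial⇒n>1)
open import Data.Nat.Primality using (prime⇒nonTrivial)
open import Relation.Nullary using (contradiction)
open Enumeration
open Basis

InLS⇔Corner : ∀ {m t g a b} → InLS m t g (a , b , m) ⇔ Corner t g a b
InLS⇔Corner = mk⇔
  (λ where (_ , _ , (i , 1≤i , i≤t , refl) , a≤ , b≤ , _) → i , 1≤i , i≤t , a≤ , b≤)
  (λ where (i , 1≤i , i≤t , a≤ , b≤) → refl , _ , (i , 1≤i , i≤t , refl) , a≤ , b≤ , ≤-refl)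

corollary5p11 : (p : ℕ) → Prime p → (m : ℕ) → 0 < m →
    (t : ℕ) (g : ℕ → ℕ) →
    g 0 ≡ 0 → g t ≡ m → (∀ i → i < t → g i < g (suc i)) →
    (∀ n → InG p m n ⇔ (∃ λ i → i ≤ t × g i ≡ n)) →
    (μ : Mult) →
    InΓ p m μ ⇔ (InLS m t g μ ⊎ ((μ₃ μ ≡ m) × (μ₁ μ ≡ 0 ⊎ μ₂ μ ≡ 0)))
corollary5p11 0 p-prime = contradiction (nonTrivial⇒n>1 0 ⦃ prime⇒nonTrivial p-prime ⦄) λ ()
corollary5p11 (suc q) p-prime m _ t g g0≡0 gt≡m step enum (a , b , m₃) = mk⇔ to from
  where
  criterion : IsBasisD (suc q) (a , b , m) (ψ (a , b , m)) (ψ′ (a , b , m)) ⇔ (Corner t g a b ⊎ (a ≡ 0 ⊎ b ≡ 0))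
  criterion = vanish⇔corner p-prime g0≡0 gt≡m (step-increasing⇒increasing step) enum
          ⇔-∘ (y^b∣ψ₂⇔vanish (suc q) a b m ⇔-∘ basis⇔y^b∣ψ₂ (suc q) a b m)
  to : InΓ (suc q) m (a , b , m₃) → InLS m t g (a , b , m₃) ⊎ ((m₃ ≡ m) × (a ≡ 0 ⊎ b ≡ 0))
  to (refl , basis) = Data.Sum.map (Equivalence.from InLS⇔Corner) (refl ,_) (Equivalence.to criterion basis)
  from : InLS m t g (a , b , m₃) ⊎ ((m₃ ≡ m) × (a ≡ 0 ⊎ b ≡ 0)) → InΓ (suc q) m (a , b , m₃)
  from (inj₁ below@(refl , _)) = refl , Equivalence.from criterion (inj₁ (Equivalence.to InLS⇔Corner below))
  from (inj₂ (refl , axis))    = refl , Equivalence.from criterion (inj₂ axis)
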